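{- Let $n \ge d \ge 2$ and let $M$ be a matching of $Q_n$ that spans at most $d$ directions. Suppose the following property holds in dimension $d$: for every matching $M'$ of $Q_d$ and every two vertices $u,v\in V(Q_d)$ of opposite parity such that $u$ is not covered by $M'$, there is a Hamilton path of $Q_d$ between $u$ and $v$ containing all edges of $M'$. Then $M$ can be extended to a Hamilton cycle of $Q_n$ (a Hamilton cycle containing all edges of $M$).
   Context: $Q_n$ is the hypercube with vertex set $\{0,1\}^n$, adjacency meaning difference in exactly one coordinate. The parity of a vertex is the parity of its number of ones. The direction of an edge $uv$ is the coordinate in which $u,v$ differ; a matching spans at most $d$ directions if its edges lie in at most $d$ distinct directions. A vertex is covered by a matching if it is an endpoint of one of its edges. -}

module Defs where

open import Data.Nat using (ℕ; zero; suc; _+_; _≤_; _^_; _%_)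
open import Data.Bool using (Bool; true; false)
open import Data.Fin using (Fin)
open import Data.Vec using (Vec; lookup; []; _∷_)
open import Data.List using (List; []; _∷_; _++_; [_]; head; last)
open import Data.List.Relation.Unary.All using (All)
open import Data.List.Relation.Unary.Any using (Any)
open import Data.List.Relation.Unary.AllPairs using (AllPairs)
open import Data.List.Relation.Unary.Unique.Propositional using (Unique)
open import Data.List.Membership.Propositional using (_∈_)
open import Data.Maybe using (just)
open import Data.Product using (Σ; _×_; ∃; ∃-syntax)
open import Data.Sum using (_⊎_)
open import Data.Unit using (⊤)
open import Relation.Binary.PropositionalEquality using (_≡_; _≢_)
open import Relation.Nullary using (¬_)

-- Vertices of Q_n: 0/1 vectors of length n (true = 1).
V : ℕ → Set
V n = Vec Bool n

AdjDir : ∀ {n} → V n → V n → Fin n → Set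
AdjDir u v i = (lookup u i ≢ lookup v i) × (∀ j → j ≢ i → lookup u j ≡ lookup v j)

Adj : ∀ {n} → V n → V n → Set
Adj {n} u v = ∃[ i ] AdjDir {n} u v i

Edge : ℕ → Set
Edge n = V n × V n

IsEdge : ∀ {n} → Edge n → Set
IsEdge (u Data.Product., v) = Adj u v

Endpoint : ∀ {n} → V n → Edge n → Set
Endpoint w (u Data.Product., v) = (w ≡ u) ⊎ (w ≡ v)

Disjoint : ∀ {n} → Edge n → Edge n → Set
Disjoint e f = ∀ w → Endpoint w e → ¬ Endpoint w f

IsMatching : ∀ {n} → List (Edge n) → Set
IsMatching M = All IsEdge M × AllPairs Disjoint M

SpansAtMost : ∀ {n} → ℕ → List (Edge n) → Set
SpansAtMost {n} d M =
  ∃[ D ] (Data.List.length {A = Fin n} D ≤ d) ×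
    All (λ e → ∃[ i ] (i ∈ D) × AdjDir (Data.Product.proj₁ e) (Data.Product.proj₂ e) i) M

Covered : ∀ {n} → V n → List (Edge n) → Set
Covered w M = Any (Endpoint w) M

ones : ∀ {n} → V n → ℕ
ones [] = 0
ones (true ∷ v) = suc (ones v)
ones (false ∷ v) = ones v

OppositeParity : ∀ {n} → V n → V n → Set
OppositeParity u v = ones u % 2 ≢ ones v % 2

IsWalk : ∀ {n} → List (V n) → Set
IsWalk [] = ⊤
IsWalk (x ∷ []) = ⊤
IsWalk (x ∷ y ∷ r) = Adj x y × IsWalk (y ∷ r)

EdgeOf : ∀ {n} → Edge n → List (V n) → Set
EdgeOf e [] = Data.Empty.⊥ where import Data.Empty
EdgeOf e (x ∷ []) = Data.Empty.⊥ where import Data.Empty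
EdgeOf (a Data.Product., b) (x ∷ y ∷ r) =
  ((x ≡ a × y ≡ b) ⊎ (x ≡ b × y ≡ a)) ⊎ EdgeOf (a Data.Product., b) (y ∷ r)

Spanning : ∀ {n} → List (V n) → Set
Spanning {n} p = Unique p × (∀ (w : V n) → w ∈ p)

HamPath : ∀ {n} → V n → V n → List (V n) → Set
HamPath u v p = Spanning p × IsWalk p × head p ≡ just u × last p ≡ just v

close : ∀ {n} → List (V n) → List (V n)
close [] = []
close (x ∷ r) = x ∷ r ++ [ x ]

HamCycle : ∀ {n} → List (V n) → Set
HamCycle p = Spanning p × IsWalk (close p)

EdgeOfCycle : ∀ {n} → Edge n → List (V n) → Set
EdgeOfCycle e p = EdgeOf e (close p)

PathProperty : ℕ → Set
PathProperty d =
  ∀ (M′ : List (Edge d)) → IsMatching M′ →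
  ∀ (u v : V d) → OppositeParity u v → ¬ Covered u M′ →
  ∃[ p ] HamPath u v p × All (λ e → EdgeOf e p) M′

-- If M covers every vertex it is a perfect matching, and we prove Fink's stronger statement: every
-- pairing P of the vertices of Q_n (n ≥ 1) into arbitrary pairs lies on a cycle through all vertices
-- that alternates between pairs of P and edges of Q_n. By induction on n, split Q_n along a direction
-- crossed by some pair, pair up the 0-ends X₀ of the crossing pairs arbitrarily, and close these
-- auxiliary pairs together with the pairs inside the 0-half into a cycle. Cutting it at the auxiliary
-- pairs leaves segments with both ends in X₀; joining the partners of the two ends of each segment
-- gives, with the pairs inside the 1-half, a pairing of the 1-half. In its cycle, replace each such
-- auxiliary pair by crossing pair, segment, crossing pair.
--
-- Otherwise some vertex u is uncovered. Order the coordinates so that Q_n = Q_m □ Q_d with every edge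
-- of M inside a copy of Q_d. The hypothesis gives in each copy a Hamilton path through its matching
-- that ends at any prescribed vertex e and starts at a neighbour of e: delete the matching edge at e,
-- take a path from e to its partner, and move e to the end. Visiting the copies in reflected Gray code
-- order and choosing the ends from the last copy backwards, only the first copy needs a prescribed
-- start, namely u, and the path ends at the vertex matching u in a neighbouring copy, closing the cycle.

{-# OPTIONS --safe #-}
module Submission where

open import Defs
open import Data.Bool using (Bool; true; false; not; _∨_; _xor_; if_then_else_)
open import Data.Bool.Properties using (not-involutive; xor-same; xor-assoc; xor-identityʳ) renaming (_≟_ to _≟ᵇ_)
open import Data.Empty using (⊥; ⊥-elim)
open import Data.Fin using (Fin; zero; suc)
import Data.Fin.Properties as Finₚ
open import Data.List using (List; []; _∷_; _++_; [_]; map; reverse; concat; concatMap; length; mapMaybe; filter; head; last)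
open import Data.List.Properties using (++-assoc; reverse-++; unfold-reverse; map-++; length-++; length-map; ++-identityʳ; length-mapMaybe)
open import Data.List.Membership.Propositional using (_∈_; find; lose)
open import Data.List.Membership.Propositional.Properties
open import Data.List.Membership.Propositional.Properties.WithK using (unique∧set⇒bag)
open import Data.List.Relation.Binary.BagAndSetEquality using (∼bag⇒↭)
open import Data.List.Relation.Binary.Permutation.Propositional as ↭ using (_↭_; ↭-sym)
import Data.List.Relation.Binary.Permutation.Propositional.Properties as ↭ₚ
open import Data.List.Relation.Unary.All as All using (All; []; _∷_)
import Data.List.Relation.Unary.All.Properties as Allₚ
open import Data.List.Relation.Unary.AllPairs as AllPairs using (AllPairs; []; _∷_)
import Data.List.Relation.Unary.AllPairs.Properties as AllPairsₚ
open import Data.List.Relation.Unary.Any as Any using (Any; here; there)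
import Data.List.Relation.Unary.Any.Properties as Anyₚ
open import Data.List.Relation.Unary.Unique.Propositional using (Unique)
import Data.List.Relation.Unary.Unique.Propositional.Properties as Uniqueₚ
open import Data.Maybe using (Maybe; just; nothing)
open import Data.Nat using (ℕ; zero; suc; _+_; _*_; _^_; _∸_; _%_; _≤_; s≤s; z≤n; _≡ᵇ_)
import Data.Nat.Properties as ℕₚ
open import Data.Product as Product using (Σ; _×_; _,_; proj₁; proj₂; ∃-syntax; swap)
open import Data.Product.Properties using () renaming (≡-dec to ×-≡-dec)
open import Data.Sum as Sum using (_⊎_; inj₁; inj₂)
open import Data.Unit using (tt)
open import Data.Vec as Vec using ([]; _∷_; lookup; insertAt; removeAt)
import Data.Vec.Properties as Vecₚ
open import Function using (_∘_; id)
open import Function.Bundles using (mk⇔)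
open import Relation.Binary.Definitions using (DecidableEquality)
open import Relation.Binary.PropositionalEquality using (_≡_; _≢_; refl; sym; trans; cong; cong₂; subst; subst₂; setoid; module ≡-Reasoning)
open import Relation.Nullary using (¬_; ¬?; Dec; yes; no)

private variable
  A B : Set

-- Lists of pairs, walks and chains

both : (A → B) → A × A → B × B
both f (x , y) = f x , f y

_∈ₚ_ : A → A × A → Set
z ∈ₚ (x , y) = z ≡ x ⊎ z ≡ y

_∈±_ : A × A → List (A × A) → Set
q ∈± P = q ∈ P ⊎ swap q ∈ P

∈±-swap : ∀ {P : List (A × A)} {q} → q ∈± P → swap q ∈± P
∈±-swap = Sum.swap

∈±-++⁻ : ∀ (P : List (A × A)) {Q q} → q ∈± (P ++ Q) → q ∈± P ⊎ q ∈± Q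
∈±-++⁻ P (inj₁ q∈) = Sum.map inj₁ inj₁ (∈-++⁻ P q∈)
∈±-++⁻ P (inj₂ q∈) = Sum.map inj₂ inj₂ (∈-++⁻ P q∈)

unpair : List (A × A) → List A
unpair [] = []
unpair ((x , y) ∷ P) = x ∷ y ∷ unpair P

unpair-++ : (P Q : List (A × A)) → unpair (P ++ Q) ≡ unpair P ++ unpair Q
unpair-++ [] Q = refl
unpair-++ ((x , y) ∷ P) Q = cong (λ l → x ∷ y ∷ l) (unpair-++ P Q)

unpair-map : ∀ (f : A → B) (P : List (A × A)) → unpair (map (both f) P) ≡ map f (unpair P)
unpair-map f [] = refl
unpair-map f ((x , y) ∷ P) = cong (λ l → f x ∷ f y ∷ l) (unpair-map f P)

unpair-reverse : ∀ (P : List (A × A)) → unpair (map swap (reverse P)) ≡ reverse (unpair P)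
unpair-reverse [] = refl
unpair-reverse ((x , y) ∷ P) = begin
    unpair (map swap (reverse ((x , y) ∷ P)))
  ≡⟨ cong (λ l → unpair (map swap l)) (unfold-reverse (x , y) P) ⟩
    unpair (map swap (reverse P ++ [ (x , y) ]))
  ≡⟨ cong unpair (map-++ swap (reverse P) [ (x , y) ]) ⟩
    unpair (map swap (reverse P) ++ [ (y , x) ])
  ≡⟨ unpair-++ (map swap (reverse P)) [ (y , x) ] ⟩
    unpair (map swap (reverse P)) ++ y ∷ x ∷ []
  ≡⟨ cong (_++ y ∷ x ∷ []) (unpair-reverse P) ⟩
    reverse (unpair P) ++ y ∷ x ∷ []
  ≡⟨ sym (++-assoc (reverse (unpair P)) [ y ] [ x ]) ⟩
    (reverse (unpair P) ++ [ y ]) ++ [ x ]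
  ≡⟨ cong (_++ [ x ]) (sym (unfold-reverse y (unpair P))) ⟩
    reverse (y ∷ unpair P) ++ [ x ]
  ≡⟨ sym (unfold-reverse x (y ∷ unpair P)) ⟩
    reverse (x ∷ y ∷ unpair P) ∎
  where open ≡-Reasoning

length-unpair : ∀ (P : List (A × A)) → length (unpair P) ≡ 2 * length P
length-unpair [] = refl
length-unpair ((x , y) ∷ P) = trans (cong (2 +_) (length-unpair P)) (sym (ℕₚ.*-suc 2 (length P)))

∈-unpair⁺ : ∀ {P : List (A × A)} {q z} → q ∈ P → z ∈ₚ q → z ∈ unpair P
∈-unpair⁺ {P = (x , y) ∷ P} (here refl) (inj₁ refl) = here refl
∈-unpair⁺ {P = (x , y) ∷ P} (here refl) (inj₂ refl) = there (here refl)
∈-unpair⁺ {P = (x , y) ∷ P} (there q∈) z∈ = there (there (∈-unpair⁺ q∈ z∈))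

∈±-unpair⁺ : ∀ {P : List (A × A)} {q z} → q ∈± P → z ∈ₚ q → z ∈ unpair P
∈±-unpair⁺ (inj₁ q∈) z∈ = ∈-unpair⁺ q∈ z∈
∈±-unpair⁺ (inj₂ q∈) z∈ = ∈-unpair⁺ q∈ (Sum.swap z∈)

∈-unpair⁻ : ∀ (P : List (A × A)) {z} → z ∈ unpair P → ∃[ q ] q ∈ P × z ∈ₚ q
∈-unpair⁻ ((x , y) ∷ P) (here refl) = (x , y) , here refl , inj₁ refl
∈-unpair⁻ ((x , y) ∷ P) (there (here refl)) = (x , y) , here refl , inj₂ refl
∈-unpair⁻ ((x , y) ∷ P) (there (there z∈)) with ∈-unpair⁻ P z∈
... | q , q∈ , z∈q = q , there q∈ , z∈q

pairUp : List A → List (A × A)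
pairUp (x ∷ y ∷ l) = (x , y) ∷ pairUp l
pairUp _ = []

unpair-pairUp : ∀ h (l : List A) → length l ≡ 2 * h → unpair (pairUp l) ≡ l
unpair-pairUp zero [] _ = refl
unpair-pairUp (suc h) (x ∷ y ∷ l) eq =
  cong (λ r → x ∷ y ∷ r) (unpair-pairUp h l (ℕₚ.suc-injective (ℕₚ.suc-injective (trans eq (ℕₚ.*-suc 2 h)))))
unpair-pairUp zero (x ∷ l) ()
unpair-pairUp (suc h) [] eq with trans eq (ℕₚ.*-suc 2 h)
... | ()
unpair-pairUp (suc h) (x ∷ []) eq with trans eq (ℕₚ.*-suc 2 h)
... | ()

unpair-↭ : ∀ {P Q : List (A × A)} → P ↭ Q → unpair P ↭ unpair Q
unpair-↭ ↭.refl = ↭.refl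
unpair-↭ (↭.prep (x , y) p) = ↭.prep x (↭.prep y (unpair-↭ p))
unpair-↭ (↭.swap (x , y) (x' , y') p) =
  ↭.trans (↭ₚ.shifts (x ∷ y ∷ []) (x' ∷ y' ∷ []))
    (↭.prep x' (↭.prep y' (↭.prep x (↭.prep y (unpair-↭ p)))))
unpair-↭ (↭.trans p q) = ↭.trans (unpair-↭ p) (unpair-↭ q)

Unique-resp-↭ : ∀ {xs ys : List A} → xs ↭ ys → Unique xs → Unique ys
Unique-resp-↭ {A = A} p = ↭ₛ.Unique-resp-↭ (↭.↭⇒↭ₛ p)
  where import Data.List.Relation.Binary.Permutation.Setoid.Properties (setoid A) as ↭ₛ

Unique-++⁻ˡ : ∀ (xs : List A) {ys} → Unique (xs ++ ys) → Unique xs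
Unique-++⁻ˡ [] _ = []
Unique-++⁻ˡ (x ∷ xs) (x∉ ∷ u) = Allₚ.++⁻ˡ xs x∉ ∷ Unique-++⁻ˡ xs u

Unique-++⁻ʳ : ∀ (xs : List A) {ys} → Unique (xs ++ ys) → Unique ys
Unique-++⁻ʳ [] u = u
Unique-++⁻ʳ (x ∷ xs) (_ ∷ u) = Unique-++⁻ʳ xs u

Unique-++-disjoint : ∀ (xs : List A) {ys z} → Unique (xs ++ ys) → z ∈ xs → z ∈ ys → ⊥
Unique-++-disjoint (x ∷ xs) (x∉ ∷ u) (here refl) z∈ys = All.lookup (Allₚ.++⁻ʳ xs x∉) z∈ys refl
Unique-++-disjoint (x ∷ xs) (_ ∷ u) (there z∈xs) z∈ys = Unique-++-disjoint xs u z∈xs z∈ys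

Unique-map⁺-on : ∀ (f : A → B) xs → Unique xs → (∀ {x y} → x ∈ xs → y ∈ xs → f x ≡ f y → x ≡ y) → Unique (map f xs)
Unique-map⁺-on f [] _ _ = []
Unique-map⁺-on f (x ∷ xs) (x∉ ∷ u) inj =
  Allₚ.map⁺ (All.tabulate (λ y∈ fx≡fy → All.lookup x∉ y∈ (inj (here refl) (there y∈) fx≡fy))) ∷
  Unique-map⁺-on f xs u (λ x∈ y∈ → inj (there x∈) (there y∈))

Unique-map⇒injective : ∀ (f : A → B) {xs x y} → Unique (map f xs) → x ∈ xs → y ∈ xs → f x ≡ f y → x ≡ y
Unique-map⇒injective f (_ ∷ _) (here refl) (here refl) _ = refl
Unique-map⇒injective f (fx∉ ∷ _) (here refl) (there y∈) eq = ⊥-elim (All.lookup fx∉ (∈-map⁺ f y∈) eq)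
Unique-map⇒injective f (fy∉ ∷ _) (there x∈) (here refl) eq = ⊥-elim (All.lookup fy∉ (∈-map⁺ f x∈) (sym eq))
Unique-map⇒injective f (_ ∷ u) (there x∈) (there y∈) eq = Unique-map⇒injective f u x∈ y∈ eq

DisjointLists : List A → List A → Set
DisjointLists xs ys = ∀ {z} → z ∈ xs → z ∈ ys → ⊥

Unique-concat⁻ : ∀ (xss : List (List A)) → Unique (concat xss) → All Unique xss × AllPairs DisjointLists xss
Unique-concat⁻ [] _ = [] , []
Unique-concat⁻ (xs ∷ xss) u with Unique-concat⁻ xss (Unique-++⁻ʳ xs u)
... | uxss , dxss = Unique-++⁻ˡ xs u ∷ uxss ,
  All.tabulate (λ ys∈ z∈xs z∈ys → Unique-++-disjoint xs u z∈xs (∈-concat⁺′ z∈ys ys∈)) ∷ dxss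

Unique-concat⁺ : ∀ {xss : List (List A)} → All Unique xss → AllPairs DisjointLists xss → Unique (concat xss)
Unique-concat⁺ us ds = Uniqueₚ.concat⁺ us (AllPairs.map (λ d {_} (z∈xs , z∈ys) → d z∈xs z∈ys) ds)

AllPairs-∈ : ∀ {R : A → A → Set} {xs x y} → AllPairs R xs → x ∈ xs → y ∈ xs → x ≢ y → R x y ⊎ R y x
AllPairs-∈ _ (here refl) (here refl) x≢y = ⊥-elim (x≢y refl)
AllPairs-∈ (rx ∷ _) (here refl) (there y∈) _ = inj₁ (All.lookup rx y∈)
AllPairs-∈ (ry ∷ _) (there x∈) (here refl) _ = inj₂ (All.lookup ry x∈)
AllPairs-∈ (_ ∷ rs) (there x∈) (there y∈) x≢y = AllPairs-∈ rs x∈ y∈ x≢y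

Unique-concatMap⇒≡ : ∀ (g : B → List A) xs {r r' z} → Unique (concatMap g xs) →
                     r ∈ xs → r' ∈ xs → z ∈ g r → z ∈ g r' → r ≡ r'
Unique-concatMap⇒≡ g (x ∷ xs) u (here refl) (here refl) _ _ = refl
Unique-concatMap⇒≡ g (x ∷ xs) u (here refl) (there r'∈) z∈ z∈' =
  ⊥-elim (Unique-++-disjoint (g x) u z∈ (∈-concatMap⁺ g (Any.map (λ { refl → z∈' }) r'∈)))
Unique-concatMap⇒≡ g (x ∷ xs) u (there r∈) (here refl) z∈ z∈' =
  ⊥-elim (Unique-++-disjoint (g x) u z∈' (∈-concatMap⁺ g (Any.map (λ { refl → z∈ }) r∈)))
Unique-concatMap⇒≡ g (x ∷ xs) u (there r∈) (there r'∈) z∈ z∈' =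
  Unique-concatMap⇒≡ g xs (Unique-++⁻ʳ (g x) u) r∈ r'∈ z∈ z∈'

Disjointₚ : A × A → A × A → Set
Disjointₚ q q' = ∀ z → z ∈ₚ q → ¬ z ∈ₚ q'

Distinctₚ : A × A → Set
Distinctₚ (x , y) = x ≢ y

Unique-unpair⁺ : ∀ (P : List (A × A)) → All Distinctₚ P → AllPairs Disjointₚ P → Unique (unpair P)
Unique-unpair⁺ [] _ _ = []
Unique-unpair⁺ ((x , y) ∷ P) (x≢y ∷ distinct) (apart ∷ disjoint) =
  (x≢y ∷ outside (inj₁ refl)) ∷ outside (inj₂ refl) ∷ Unique-unpair⁺ P distinct disjoint
  where
  outside : ∀ {z} → z ∈ₚ (x , y) → All (z ≢_) (unpair P)
  outside z∈xy = All.tabulate λ w∈ z≡w →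
    let q , q∈ , w∈q = ∈-unpair⁻ P w∈ in All.lookup apart q∈ _ z∈xy (subst (_∈ₚ q) (sym z≡w) w∈q)

Unique-unpair⁻ : ∀ (P : List (A × A)) → Unique (unpair P) → All Distinctₚ P × AllPairs Disjointₚ P
Unique-unpair⁻ [] _ = [] , []
Unique-unpair⁻ ((x , y) ∷ P) (x∉ ∷ y∉ ∷ u) with Unique-unpair⁻ P u
... | distinct , disjoint = All.head x∉ ∷ distinct , All.tabulate (λ q∈ z z∈xy z∈q → inside z∈xy (∈-unpair⁺ q∈ z∈q)) ∷ disjoint
  where
  inside : ∀ {z} → z ∈ₚ (x , y) → ¬ z ∈ unpair P
  inside (inj₁ refl) z∈ = All.lookup (All.tail x∉) z∈ refl
  inside (inj₂ refl) z∈ = All.lookup y∉ z∈ refl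

Walk : (A → A → Set) → A → List A → A → Set
Walk R a [] b = a ≡ b
Walk R a (y ∷ l) b = R a y × Walk R y l b

Walk-++ : ∀ {R : A → A → Set} {a b c e} l m → Walk R a l b → R b c → Walk R c m e → Walk R a (l ++ c ∷ m) e
Walk-++ [] m refl r w = r , w
Walk-++ (y ∷ l) m (r , w₁) r' w₂ = r , Walk-++ l m w₁ r' w₂

Walk-map : ∀ {R : A → A → Set} {S : B → B → Set} (f : A → B) → (∀ {x y} → R x y → S (f x) (f y)) →
           ∀ {a b} l → Walk R a l b → Walk S (f a) (map f l) (f b)
Walk-map f h [] refl = refl
Walk-map f h (y ∷ l) (r , w) = h r , Walk-map f h l w

Walk-last : ∀ {R : A → A → Set} {a b} l → Walk R a l b → ∃[ l' ] a ∷ l ≡ l' ++ [ b ]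
Walk-last [] refl = [] , refl
Walk-last {a = a} (y ∷ l) (_ , w) with Walk-last l w
... | l' , eq = a ∷ l' , cong (a ∷_) eq

Consecutive : A → A → List A → Set
Consecutive a b [] = ⊥
Consecutive a b (x ∷ []) = ⊥
Consecutive a b (x ∷ y ∷ r) = ((x ≡ a × y ≡ b) ⊎ (x ≡ b × y ≡ a)) ⊎ Consecutive a b (y ∷ r)

Consecutive-++ˡ : ∀ {a b : A} xs ys → Consecutive a b xs → Consecutive a b (xs ++ ys)
Consecutive-++ˡ (x ∷ y ∷ xs) ys (inj₁ p) = inj₁ p
Consecutive-++ˡ (x ∷ y ∷ xs) ys (inj₂ p) = inj₂ (Consecutive-++ˡ (y ∷ xs) ys p)

Consecutive-++ʳ : ∀ {a b : A} xs ys → Consecutive a b ys → Consecutive a b (xs ++ ys)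
Consecutive-++ʳ [] ys p = p
Consecutive-++ʳ (x ∷ []) (y ∷ ys) p = inj₂ p
Consecutive-++ʳ (x ∷ x' ∷ xs) ys p = inj₂ (Consecutive-++ʳ (x' ∷ xs) ys p)

Consecutive-sym : ∀ {a b : A} xs → Consecutive a b xs → Consecutive b a xs
Consecutive-sym (x ∷ y ∷ xs) (inj₁ p) = inj₁ (Sum.swap p)
Consecutive-sym (x ∷ y ∷ xs) (inj₂ p) = inj₂ (Consecutive-sym (y ∷ xs) p)

Consecutive-map : ∀ {a b : A} (f : A → B) xs → Consecutive a b xs → Consecutive (f a) (f b) (map f xs)
Consecutive-map f (x ∷ y ∷ xs) (inj₁ (inj₁ (refl , refl))) = inj₁ (inj₁ (refl , refl))
Consecutive-map f (x ∷ y ∷ xs) (inj₁ (inj₂ (refl , refl))) = inj₁ (inj₂ (refl , refl))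
Consecutive-map f (x ∷ y ∷ xs) (inj₂ p) = inj₂ (Consecutive-map f (y ∷ xs) p)

Consecutive-unpair : ∀ (C : List (A × A)) {q} → q ∈ C → Consecutive (proj₁ q) (proj₂ q) (unpair C)
Consecutive-unpair ((x , y) ∷ C) (here refl) = inj₁ (inj₁ (refl , refl))
Consecutive-unpair ((x , y) ∷ C) (there q∈) = Consecutive-++ʳ (x ∷ y ∷ []) (unpair C) (Consecutive-unpair C q∈)

Linked : (A → A → Set) → A → List (A × A) → A → Set
Linked R s [] e = R s e
Linked R s ((x , y) ∷ l) e = R s x × Linked R y l e

LinkedUntil : (A → A → Set) → A → List (A × A) → A → Set
LinkedUntil R s [] v = s ≡ v
LinkedUntil R s ((x , y) ∷ l) v = R s x × LinkedUntil R y l v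

Cyclic : (A → A → Set) → List (A × A) → Set
Cyclic R [] = ⊥
Cyclic R ((x , y) ∷ l) = Linked R y l x

LinkedUntil-++ : ∀ {R : A → A → Set} {s v e} l m → LinkedUntil R s l v → Linked R v m e → Linked R s (l ++ m) e
LinkedUntil-++ [] m refl c = c
LinkedUntil-++ ((x , y) ∷ l) m (r , p) c = r , LinkedUntil-++ l m p c

Linked-∷ʳ : ∀ {R : A → A → Set} {s x y} l → Linked R s l x → LinkedUntil R s (l ++ (x , y) ∷ []) y
Linked-∷ʳ [] r = r , refl
Linked-∷ʳ ((a , b) ∷ l) (r , c) = r , Linked-∷ʳ l c

Linked-++⁻ : ∀ {R : A → A → Set} {s e x y} l m → Linked R s (l ++ (x , y) ∷ m) e → Linked R s l x × Linked R y m e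
Linked-++⁻ [] m (r , c) = r , c
Linked-++⁻ ((a , b) ∷ l) m (r , c) with Linked-++⁻ l m c
... | c₁ , c₂ = (r , c₁) , c₂

Linked-++⁺ : ∀ {R : A → A → Set} {s e x y} l m → Linked R s l x → Linked R y m e → Linked R s (l ++ (x , y) ∷ m) e
Linked-++⁺ [] m r c = r , c
Linked-++⁺ ((a , b) ∷ l) m (r , c₁) c₂ = r , Linked-++⁺ l m c₁ c₂

Linked-map : ∀ {R : A → A → Set} {S : B → B → Set} (f : A → B) → (∀ {x y} → R x y → S (f x) (f y)) →
             ∀ {s e} l → Linked R s l e → Linked S (f s) (map (both f) l) (f e)
Linked-map f h [] r = h r
Linked-map f h ((x , y) ∷ l) (r , c) = h r , Linked-map f h l c

Linked-reverse : ∀ {R : A → A → Set} → (∀ {x y} → R x y → R y x) →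
                 ∀ {s e} l → Linked R s l e → Linked R e (map swap (reverse l)) s
Linked-reverse sym-R [] r = sym-R r
Linked-reverse sym-R ((x , y) ∷ l) (r , c) rewrite unfold-reverse (x , y) l | map-++ swap (reverse l) ((x , y) ∷ []) =
  Linked-++⁺ (map swap (reverse l)) [] (Linked-reverse sym-R l c) (sym-R r)

Linked⇒Walk : ∀ {R : A → A → Set} {s e} l → All (λ (a , b) → R a b) l → Linked R s l e → Walk R s (unpair l ++ [ e ]) e
Linked⇒Walk [] [] r = r , refl
Linked⇒Walk ((x , y) ∷ l) (xy ∷ rs) (r , c) = r , xy , Linked⇒Walk l rs c

Cyclic-rotate : ∀ {R : A → A → Set} (C : List (A × A)) {q} → q ∈ C → Cyclic R C → ∃[ l ] (q ∷ l) ↭ C × Cyclic R (q ∷ l)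
Cyclic-rotate C q∈ cyc with ∈-∃++ q∈
... | [] , l , refl = l , ↭.refl , cyc
... | p ∷ pre , post , refl with Linked-++⁻ pre post cyc
... | c₁ , c₂ = post ++ p ∷ pre , ↭ₚ.++-comm (_ ∷ post) (p ∷ pre) , Linked-++⁺ post pre c₂ c₁

∈-mapMaybe⁻ : ∀ (f : A → Maybe B) xs {y} → y ∈ mapMaybe f xs → ∃[ x ] x ∈ xs × f x ≡ just y
∈-mapMaybe⁻ f (x ∷ xs) y∈ with f x in eq
∈-mapMaybe⁻ f (x ∷ xs) (here refl) | just _ = x , here refl , eq
∈-mapMaybe⁻ f (x ∷ xs) (there y∈) | just _ with ∈-mapMaybe⁻ f xs y∈
... | x' , x'∈ , eq' = x' , there x'∈ , eq'
∈-mapMaybe⁻ f (x ∷ xs) y∈ | nothing with ∈-mapMaybe⁻ f xs y∈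
... | x' , x'∈ , eq' = x' , there x'∈ , eq'

∈-mapMaybe⁺ : ∀ (f : A → Maybe B) {xs x y} → x ∈ xs → f x ≡ just y → y ∈ mapMaybe f xs
∈-mapMaybe⁺ f {x ∷ xs} (here refl) eq with f x
∈-mapMaybe⁺ f {x ∷ xs} (here refl) refl | just _ = here refl
∈-mapMaybe⁺ f {x ∷ xs} (there x∈) eq with f x
... | just _ = there (∈-mapMaybe⁺ f x∈ eq)
... | nothing = ∈-mapMaybe⁺ f x∈ eq

All-mapMaybe⁺ : ∀ {Q : B → Set} (f : A → Maybe B) xs → (∀ {x y} → x ∈ xs → f x ≡ just y → Q y) → All Q (mapMaybe f xs)
All-mapMaybe⁺ f xs h = All.tabulate λ y∈ → let x , x∈ , eq = ∈-mapMaybe⁻ f xs y∈ in h x∈ eq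

AllPairs-mapMaybe⁺ : ∀ {R : A → A → Set} {S : B → B → Set} (f : A → Maybe B) {xs} → AllPairs R xs →
                     (∀ {x x' y y'} → x ∈ xs → x' ∈ xs → f x ≡ just y → f x' ≡ just y' → R x x' → S y y') → AllPairs S (mapMaybe f xs)
AllPairs-mapMaybe⁺ f [] h = []
AllPairs-mapMaybe⁺ f {x ∷ xs} (rx ∷ rs) h with f x in eq
... | just _ = All-mapMaybe⁺ f xs (λ x'∈ eq' → h (here refl) (there x'∈) eq eq' (All.lookup rx x'∈)) ∷
               AllPairs-mapMaybe⁺ f rs (λ x∈ x'∈ → h (there x∈) (there x'∈))
... | nothing = AllPairs-mapMaybe⁺ f rs (λ x∈ x'∈ → h (there x∈) (there x'∈))

Unique-mapMaybe⁺ : ∀ (f : A → Maybe B) → (∀ {x x' y} → f x ≡ just y → f x' ≡ just y → x ≡ x') →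
                   ∀ {xs} → Unique xs → Unique (mapMaybe f xs)
Unique-mapMaybe⁺ f inj u = AllPairs-mapMaybe⁺ f u λ _ _ eq eq' x≢x' y≡y' → x≢x' (inj eq (subst (λ y → f _ ≡ just y) (sym y≡y') eq'))

length-mapMaybe-< : ∀ (f : A → Maybe B) {xs x} → x ∈ xs → f x ≡ nothing → suc (length (mapMaybe f xs)) ≤ length xs
length-mapMaybe-< f {x ∷ xs} (here refl) eq with f x
length-mapMaybe-< f {x ∷ xs} (here refl) () | just _
... | nothing = s≤s (length-mapMaybe f xs)
length-mapMaybe-< f {x ∷ xs} (there x∈) eq with f x
... | just _ = s≤s (length-mapMaybe-< f x∈ eq)
... | nothing = ℕₚ.m≤n⇒m≤1+n (length-mapMaybe-< f x∈ eq)

-- The hypercube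

_≟V_ : ∀ {n} → DecidableEquality (V n)
_≟V_ = Vecₚ.≡-dec _≟ᵇ_

_≟E_ : ∀ {n} → DecidableEquality (Edge n)
_≟E_ = ×-≡-dec _≟V_ _≟V_

lookup-ext : ∀ {n} {u v : V n} → (∀ j → lookup u j ≡ lookup v j) → u ≡ v
lookup-ext {u = u} {v} eq = trans (sym (Vecₚ.tabulate∘lookup u)) (trans (Vecₚ.tabulate-cong eq) (Vecₚ.tabulate∘lookup v))

AdjDir-zero⁻ : ∀ {n} {a b : Bool} {u v : V n} → AdjDir (a ∷ u) (b ∷ v) zero → a ≢ b × u ≡ v
AdjDir-zero⁻ (a≢b , eq) = a≢b , lookup-ext (λ j → eq (suc j) λ ())

AdjDir-suc⁻ : ∀ {n} {a b : Bool} {u v : V n} {i} → AdjDir (a ∷ u) (b ∷ v) (suc i) → a ≡ b × AdjDir u v i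
AdjDir-suc⁻ (ne , eq) = eq zero (λ ()) , ne , λ j j≢i → eq (suc j) (λ e → j≢i (Finₚ.suc-injective e))

Adj-head : ∀ {n} {a b : Bool} {u : V n} → a ≢ b → Adj (a ∷ u) (b ∷ u)
Adj-head a≢b = zero , a≢b , λ { zero 0≢0 → ⊥-elim (0≢0 refl) ; (suc j) _ → refl }

Adj-∷ : ∀ {n} {a : Bool} {u v : V n} → Adj u v → Adj (a ∷ u) (a ∷ v)
Adj-∷ (i , ne , eq) = suc i , ne , λ { zero _ → refl ; (suc j) j≢i → eq j (λ e → j≢i (cong suc e)) }

Adj-∷⁻ : ∀ {n} {a b : Bool} {u v : V n} → Adj (a ∷ u) (b ∷ v) → (a ≢ b × u ≡ v) ⊎ (a ≡ b × Adj u v)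
Adj-∷⁻ (zero , ad) = inj₁ (AdjDir-zero⁻ ad)
Adj-∷⁻ (suc i , ad) with AdjDir-suc⁻ ad
... | a≡b , ad' = inj₂ (a≡b , i , ad')

Adj-sym : ∀ {n} {u v : V n} → Adj u v → Adj v u
Adj-sym (i , ne , eq) = i , (λ e → ne (sym e)) , λ j j≢i → sym (eq j j≢i)

Adj-irrefl : ∀ {n} {u : V n} → ¬ Adj u u
Adj-irrefl (_ , ne , _) = ne refl

Adj⇒≢ : ∀ {n} {u v : V n} → Adj u v → u ≢ v
Adj⇒≢ {u = u} ad refl = Adj-irrefl {u = u} ad

b≢not-b : ∀ (b : Bool) → b ≢ not b
b≢not-b false ()
b≢not-b true ()

flipHead : ∀ {m} → V m → V m
flipHead [] = []
flipHead (b ∷ w) = not b ∷ w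

flipHead-involutive : ∀ {m} (w : V m) → flipHead (flipHead w) ≡ w
flipHead-involutive [] = refl
flipHead-involutive (b ∷ w) = cong (_∷ w) (not-involutive b)

Adj-flipHead : ∀ {n} (u : V (suc n)) → Adj u (flipHead u)
Adj-flipHead (b ∷ u) = Adj-head (b≢not-b b)

parity : ∀ {n} → V n → Bool
parity [] = false
parity (b ∷ u) = b xor parity u

Adj⇒parity≡not : ∀ {n} {u v : V n} → Adj u v → parity u ≡ not (parity v)
Adj⇒parity≡not {u = a ∷ u} {b ∷ v} ad with Adj-∷⁻ ad
... | inj₁ (a≢b , refl) = flipped a b a≢b
  where flipped : ∀ a b → a ≢ b → a xor parity u ≡ not (b xor parity u)
        flipped false false a≢b = ⊥-elim (a≢b refl)
        flipped false true _ = sym (not-involutive (parity u))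
        flipped true false _ = refl
        flipped true true a≢b = ⊥-elim (a≢b refl)
... | inj₂ (refl , ad') = trans (cong (a xor_) (Adj⇒parity≡not {u = u} {v} ad')) (xor-not a (parity v))
  where xor-not : ∀ a c → a xor not c ≡ not (a xor c)
        xor-not false c = refl
        xor-not true c = refl

bit : Bool → ℕ
bit true = 1
bit false = 0

ones%2≡bit-parity : ∀ {n} (u : V n) → ones u % 2 ≡ bit (parity u)
ones%2≡bit-parity [] = refl
ones%2≡bit-parity (false ∷ u) = ones%2≡bit-parity u
ones%2≡bit-parity (true ∷ u) = trans (suc%2 (ones u)) (trans (cong (1 ∸_) (ones%2≡bit-parity u)) (1∸bit (parity u)))
  where
  suc%2 : ∀ k → suc k % 2 ≡ 1 ∸ k % 2
  suc%2 0 = refl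
  suc%2 1 = refl
  suc%2 (suc (suc k)) = suc%2 k
  1∸bit : ∀ b → 1 ∸ bit b ≡ bit (not b)
  1∸bit true = refl
  1∸bit false = refl

bit-injective : ∀ {a b} → bit a ≡ bit b → a ≡ b
bit-injective {true} {true} _ = refl
bit-injective {false} {false} _ = refl

parity≢⇒OppositeParity : ∀ {n} {u v : V n} → parity u ≢ parity v → OppositeParity u v
parity≢⇒OppositeParity {u = u} {v} ne eq =
  ne (bit-injective (trans (sym (ones%2≡bit-parity u)) (trans eq (ones%2≡bit-parity v))))

Adj⇒OppositeParity : ∀ {n} {u v : V n} → Adj u v → OppositeParity u v
Adj⇒OppositeParity {u = u} {v} ad =
  parity≢⇒OppositeParity {u = u} {v} λ eq → b≢not-b (parity v) (trans (sym eq) (Adj⇒parity≡not {u = u} {v} ad))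

vertices : ∀ n → List (V n)
vertices zero = [] ∷ []
vertices (suc n) = map (false ∷_) (vertices n) ++ map (true ∷_) (vertices n)

∈-vertices : ∀ {n} (v : V n) → v ∈ vertices n
∈-vertices [] = here refl
∈-vertices {suc n} (false ∷ v) = ∈-++⁺ˡ (∈-map⁺ (false ∷_) (∈-vertices v))
∈-vertices {suc n} (true ∷ v) = ∈-++⁺ʳ (map (false ∷_) (vertices n)) (∈-map⁺ (true ∷_) (∈-vertices v))

Unique-vertices : ∀ n → Unique (vertices n)
Unique-vertices zero = [] ∷ []
Unique-vertices (suc n) =
  Uniqueₚ.++⁺ (Uniqueₚ.map⁺ Vecₚ.∷-injectiveʳ (Unique-vertices n)) (Uniqueₚ.map⁺ Vecₚ.∷-injectiveʳ (Unique-vertices n)) halves-disjoint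
  where
  halves-disjoint : ∀ {z} → z ∈ map (false ∷_) (vertices n) × z ∈ map (true ∷_) (vertices n) → ⊥
  halves-disjoint (z∈₀ , z∈₁) with ∈-map⁻ (false ∷_) z∈₀ | ∈-map⁻ (true ∷_) z∈₁
  ... | _ , _ , refl | _ , _ , ()

length-vertices : ∀ n → length (vertices n) ≡ 2 ^ n
length-vertices zero = refl
length-vertices (suc n) = begin
    length (map (false ∷_) (vertices n) ++ map (true ∷_) (vertices n))
  ≡⟨ length-++ (map (false ∷_) (vertices n)) ⟩
    length (map (false ∷_) (vertices n)) + length (map (true ∷_) (vertices n))
  ≡⟨ cong₂ _+_ (length-map (false ∷_) (vertices n)) (length-map (true ∷_) (vertices n)) ⟩
    length (vertices n) + length (vertices n)
  ≡⟨ cong₂ _+_ (length-vertices n) (trans (length-vertices n) (sym (ℕₚ.+-identityʳ (2 ^ n)))) ⟩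
    2 ^ n + (2 ^ n + 0) ∎
  where open ≡-Reasoning

length-spanning : ∀ {n} {xs : List (V n)} → Unique xs → (∀ v → v ∈ xs) → length xs ≡ 2 ^ n
length-spanning {n} u c = trans (↭ₚ.↭-length (∼bag⇒↭ (unique∧set⇒bag u (Unique-vertices n) (mk⇔ (λ _ → ∈-vertices _) (λ _ → c _)))))
                                (length-vertices n)

differingCoordinate : ∀ {n} {u v : V n} → u ≢ v → ∃[ i ] lookup u i ≢ lookup v i
differingCoordinate {u = []} {[]} ne = ⊥-elim (ne refl)
differingCoordinate {u = a ∷ u} {b ∷ v} ne with a ≟ᵇ b
... | no a≢b = zero , a≢b
... | yes refl with differingCoordinate (λ e → ne (cong (a ∷_) e))
... | i , d = suc i , d

-- Fink's theorem for pairings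

record IsPairing {n} (P : List (V n × V n)) : Set where
  constructor mkPairing
  field
    unique : Unique (unpair P)
    spanning : ∀ v → v ∈ unpair P

-- C lists, in cyclic order, the pairs of a Hamilton cycle of the complete graph on V n that
-- alternates between pairs of P (in either orientation) and edges of Q_n.
record IsAltHamCycle {n} (P C : List (V n × V n)) : Set where
  constructor mkAltHamCycle
  field
    pairing : IsPairing C
    ⊆±P : All (_∈± P) C
    cyclic : Cyclic Adj C

FinkProperty : ℕ → Set
FinkProperty n = ∀ (P : List (V n × V n)) → IsPairing P → ∃[ C ] IsAltHamCycle P C

fink-one : FinkProperty 1
fink-one [] (mkPairing _ spanning) with spanning (false ∷ [])
... | ()
fink-one P@((x , y) ∷ []) pairing@(mkPairing ((x≢y ∷ []) ∷ _) _) =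
  P , mkAltHamCycle pairing (inj₁ (here refl) ∷ []) (V1-adj (x≢y ∘ sym))
  where
  V1-adj : ∀ {u v : V 1} → u ≢ v → Adj u v
  V1-adj {a ∷ []} {b ∷ []} u≢v = Adj-head (λ a≡b → u≢v (cong (_∷ []) a≡b))
fink-one ((x , y) ∷ (z , _) ∷ _) (mkPairing ((x≢y ∷ x≢z ∷ _) ∷ (y≢z ∷ _) ∷ _) _) = ⊥-elim (no-three x≢y x≢z y≢z)
  where
  no-three : ∀ {x y z : V 1} → x ≢ y → x ≢ z → y ≢ z → ⊥
  no-three {false ∷ []} {false ∷ []} x≢y _ _ = x≢y refl
  no-three {true ∷ []} {true ∷ []} x≢y _ _ = x≢y refl
  no-three {false ∷ []} {true ∷ []} {false ∷ []} _ x≢z _ = x≢z refl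
  no-three {false ∷ []} {true ∷ []} {true ∷ []} _ _ y≢z = y≢z refl
  no-three {true ∷ []} {false ∷ []} {false ∷ []} _ _ y≢z = y≢z refl
  no-three {true ∷ []} {false ∷ []} {true ∷ []} _ x≢z _ = x≢z refl

module Halves {n} (t : Fin (suc n)) where

  lift : Bool → V n → V (suc n)
  lift b w = insertAt w t b

  drop : V (suc n) → V n
  drop v = removeAt v t

  lookup-lift : ∀ b w → lookup (lift b w) t ≡ b
  lookup-lift b w = Vecₚ.insertAt-lookup w t b

  drop-lift : ∀ b w → drop (lift b w) ≡ w
  drop-lift b w = Vecₚ.removeAt-insertAt w t b

  lift-drop : ∀ {b} v → lookup v t ≡ b → lift b (drop v) ≡ v
  lift-drop v refl = Vecₚ.insertAt-removeAt v t

  lift-injective : ∀ {b b' w w'} → lift b w ≡ lift b' w' → w ≡ w'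
  lift-injective {b} {b'} {w} {w'} eq = trans (sym (drop-lift b w)) (trans (cong drop eq) (drop-lift b' w'))

  lift-false≢lift-true : ∀ {w w'} → lift false w ≢ lift true w'
  lift-false≢lift-true {w} {w'} eq with trans (sym (lookup-lift false w)) (trans (cong (λ v → lookup v t) eq) (lookup-lift true w'))
  ... | ()

  Adj-lift : ∀ b {w w'} → Adj w w' → Adj (lift b w) (lift b w')
  Adj-lift b ad = go t ad
    where
    go : ∀ {n} (t : Fin (suc n)) {w w' : V n} → Adj w w' → Adj (insertAt w t b) (insertAt w' t b)
    go zero ad = Adj-∷ ad
    go {suc n} (suc t) {x ∷ w} {x' ∷ w'} ad with Adj-∷⁻ {u = w} {w'} ad
    ... | inj₁ (x≢x' , refl) = Adj-head x≢x'
    ... | inj₂ (refl , ad') = Adj-∷ (go t ad')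

  project : Bool → V (suc n) → Maybe (V n)
  project b v = if lookup v t xor b then nothing else just (drop v)

  project-just⁻ : ∀ b {v w} → project b v ≡ just w → v ≡ lift b w
  project-just⁻ false {v} eq with lookup v t in v∈
  project-just⁻ false {v} refl | false = sym (lift-drop v v∈)
  project-just⁻ true {v} eq with lookup v t in v∈
  project-just⁻ true {v} refl | true = sym (lift-drop v v∈)

  project-lift : ∀ b w → project b (lift b w) ≡ just w
  project-lift b w rewrite lookup-lift b w | xor-same b = cong just (drop-lift b w)

  inner : Bool → List (V (suc n) × V (suc n)) → List (V n × V n)
  inner b [] = []
  inner b ((x , y) ∷ P) =
    if (lookup x t xor b) ∨ (lookup y t xor b) then inner b P else (drop x , drop y) ∷ inner b P

  crossing : List (V (suc n) × V (suc n)) → List (V n × V n)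
  crossing [] = []
  crossing ((x , y) ∷ P) with lookup x t | lookup y t
  ... | false | true = (drop x , drop y) ∷ crossing P
  ... | true | false = (drop y , drop x) ∷ crossing P
  ... | _ | _ = crossing P

  side : Bool → V n × V n → V n
  side false = proj₁
  side true = proj₂

  split-↭ : ∀ b P → unpair (inner b P) ++ map (side b) (crossing P) ↭ mapMaybe (project b) (unpair P)
  split-↭ b [] = ↭.refl
  split-↭ false ((x , y) ∷ P) with lookup x t | lookup y t
  ... | false | false = ↭.prep _ (↭.prep _ (split-↭ false P))
  ... | false | true = ↭.trans (↭ₚ.shift _ (unpair (inner false P)) _) (↭.prep _ (split-↭ false P))
  ... | true | false = ↭.trans (↭ₚ.shift _ (unpair (inner false P)) _) (↭.prep _ (split-↭ false P))
  ... | true | true = split-↭ false P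
  split-↭ true ((x , y) ∷ P) with lookup x t | lookup y t
  ... | false | false = split-↭ true P
  ... | false | true = ↭.trans (↭ₚ.shift _ (unpair (inner true P)) _) (↭.prep _ (split-↭ true P))
  ... | true | false = ↭.trans (↭ₚ.shift _ (unpair (inner true P)) _) (↭.prep _ (split-↭ true P))
  ... | true | true = ↭.prep _ (↭.prep _ (split-↭ true P))

  inner-lift : ∀ b P {q} → q ∈ inner b P → both (lift b) q ∈ P
  inner-lift false ((x , y) ∷ P) q∈ with lookup x t in x∈ | lookup y t in y∈
  inner-lift false ((x , y) ∷ P) (here refl) | false | false rewrite lift-drop x x∈ | lift-drop y y∈ = here refl
  inner-lift false ((x , y) ∷ P) (there q∈) | false | false = there (inner-lift false P q∈)
  ... | false | true = there (inner-lift false P q∈)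
  ... | true | false = there (inner-lift false P q∈)
  ... | true | true = there (inner-lift false P q∈)
  inner-lift true ((x , y) ∷ P) q∈ with lookup x t in x∈ | lookup y t in y∈
  inner-lift true ((x , y) ∷ P) (here refl) | true | true rewrite lift-drop x x∈ | lift-drop y y∈ = here refl
  inner-lift true ((x , y) ∷ P) (there q∈) | true | true = there (inner-lift true P q∈)
  ... | false | false = there (inner-lift true P q∈)
  ... | false | true = there (inner-lift true P q∈)
  ... | true | false = there (inner-lift true P q∈)

  crossing-lift : ∀ P {c} → c ∈ crossing P → (lift false (proj₁ c) , lift true (proj₂ c)) ∈± P
  crossing-lift ((x , y) ∷ P) c∈ with lookup x t in x∈ | lookup y t in y∈
  crossing-lift ((x , y) ∷ P) (here refl) | false | true rewrite lift-drop x x∈ | lift-drop y y∈ = inj₁ (here refl)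
  crossing-lift ((x , y) ∷ P) (here refl) | true | false rewrite lift-drop x x∈ | lift-drop y y∈ = inj₂ (here refl)
  crossing-lift ((x , y) ∷ P) (there c∈) | false | true = Sum.map there there (crossing-lift P c∈)
  crossing-lift ((x , y) ∷ P) (there c∈) | true | false = Sum.map there there (crossing-lift P c∈)
  ... | false | false = Sum.map there there (crossing-lift P c∈)
  ... | true | true = Sum.map there there (crossing-lift P c∈)

  crossing-nonempty : ∀ P {x y} → (x , y) ∈ P → lookup x t ≢ lookup y t → ∃[ c ] c ∈ crossing P
  crossing-nonempty ((x , y) ∷ P) (here refl) x≢y with lookup x t | lookup y t
  ... | false | false = ⊥-elim (x≢y refl)
  ... | false | true = _ , here refl
  ... | true | false = _ , here refl
  ... | true | true = ⊥-elim (x≢y refl)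
  crossing-nonempty ((x , y) ∷ P) (there xy∈) x≢y with lookup x t | lookup y t
  ... | false | false = crossing-nonempty P xy∈ x≢y
  ... | false | true = _ , there (proj₂ (crossing-nonempty P xy∈ x≢y))
  ... | true | false = _ , there (proj₂ (crossing-nonempty P xy∈ x≢y))
  ... | true | true = crossing-nonempty P xy∈ x≢y

  module _ {P : List (V (suc n) × V (suc n))} (P-pairing : IsPairing P) where
    open IsPairing P-pairing

    halfVertices : Bool → List (V n)
    halfVertices b = unpair (inner b P) ++ map (side b) (crossing P)

    Unique-halfVertices : ∀ b → Unique (halfVertices b)
    Unique-halfVertices b = Unique-resp-↭ (↭-sym (split-↭ b P))
      (Unique-mapMaybe⁺ (project b) (λ eq eq' → trans (project-just⁻ b eq) (sym (project-just⁻ b eq'))) unique)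

    ∈-halfVertices : ∀ b w → w ∈ halfVertices b
    ∈-halfVertices b w = ↭ₚ.∈-resp-↭ (↭-sym (split-↭ b P)) (∈-mapMaybe⁺ (project b) (spanning (lift b w)) (project-lift b w))

IsAltHamCycle-rotate : ∀ {n} {P C : List (V n × V n)} {q} → IsAltHamCycle P C → q ∈ C → ∃[ l ] IsAltHamCycle P (q ∷ l)
IsAltHamCycle-rotate {C = C} (mkAltHamCycle (mkPairing unique spanning) ⊆±P cyclic) q∈ with Cyclic-rotate C q∈ cyclic
... | l , q∷l↭C , cyclic' = l , mkAltHamCycle
  (mkPairing (Unique-resp-↭ (↭-sym (unpair-↭ q∷l↭C)) unique) (λ v → ↭ₚ.∈-resp-↭ (↭-sym (unpair-↭ q∷l↭C)) (spanning v)))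
  (↭ₚ.All-resp-↭ (↭-sym q∷l↭C) ⊆±P) cyclic'

_∈±?_ : ∀ {n} (q : V n × V n) P → Dec (q ∈± P)
q ∈±? P with q ∈? P | swap q ∈? P
  where open import Data.List.Membership.DecPropositional _≟E_ using (_∈?_)
... | yes q∈ | _ = yes (inj₁ q∈)
... | no _ | yes q∈ = yes (inj₂ q∈)
... | no q∉ | no q̃∉ = no λ { (inj₁ q∈) → q∉ q∈ ; (inj₂ q∈) → q̃∉ q∈ }

-- Returns x itself when x is not a first component.
associate : ∀ {n} → List (V n × V n) → V n → V n
associate [] x = x
associate ((a , b) ∷ r) x with x ≟V a
... | yes _ = b
... | no _ = associate r x

associate-∈ : ∀ {n} (r : List (V n × V n)) {x} → x ∈ map proj₁ r → (x , associate r x) ∈ r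
associate-∈ ((a , b) ∷ r) {x} x∈ with x ≟V a
... | yes refl = here refl
associate-∈ ((a , b) ∷ r) (here refl) | no x≢a = ⊥-elim (x≢a refl)
associate-∈ ((a , b) ∷ r) (there x∈) | no _ = there (associate-∈ r x∈)

module FinkStep {n} (fink-IH : FinkProperty (suc n)) (t : Fin (suc (suc n)))
  (P : List (V (suc (suc n)) × V (suc (suc n)))) (P-pairing : IsPairing P)
  {x₀ y₀} (xy₀∈P : (x₀ , y₀) ∈ P) (xy₀-crosses : lookup x₀ t ≢ lookup y₀ t) where

  open Halves t

  U W : Set
  U = V (suc (suc n))
  W = V (suc n)

  lift₀ lift₁ : W → U
  lift₀ = lift false
  lift₁ = lift true

  P₀ P₁ X : List (W × W)
  P₀ = inner false P
  P₁ = inner true P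
  X = crossing P

  X₀ X₁ : List W
  X₀ = map proj₁ X
  X₁ = map proj₂ X

  Unique-X₀ : Unique X₀
  Unique-X₀ = Unique-++⁻ʳ (unpair P₀) (Unique-halfVertices P-pairing false)

  Unique-X₁ : Unique X₁
  Unique-X₁ = Unique-++⁻ʳ (unpair P₁) (Unique-halfVertices P-pairing true)

  P₀∌X₀ : ∀ {z} → z ∈ unpair P₀ → z ∈ X₀ → ⊥
  P₀∌X₀ = Unique-++-disjoint (unpair P₀) (Unique-halfVertices P-pairing false)

  P₁∌X₁ : ∀ {z} → z ∈ unpair P₁ → z ∈ X₁ → ⊥
  P₁∌X₁ = Unique-++-disjoint (unpair P₁) (Unique-halfVertices P-pairing true)

  X₀-even : ∃[ h ] length X₀ ≡ 2 * h
  X₀-even = 2 ^ n ∸ length P₀ , (begin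
      length X₀
    ≡⟨ sym (ℕₚ.m+n∸m≡n (2 * length P₀) (length X₀)) ⟩
      2 * length P₀ + length X₀ ∸ 2 * length P₀
    ≡⟨ cong (λ k → k + length X₀ ∸ 2 * length P₀) (sym (length-unpair P₀)) ⟩
      length (unpair P₀) + length X₀ ∸ 2 * length P₀
    ≡⟨ cong (_∸ 2 * length P₀) (sym (length-++ (unpair P₀))) ⟩
      length (unpair P₀ ++ X₀) ∸ 2 * length P₀
    ≡⟨ cong (_∸ 2 * length P₀) (length-spanning (Unique-halfVertices P-pairing false) (∈-halfVertices P-pairing false)) ⟩
      2 * 2 ^ n ∸ 2 * length P₀
    ≡⟨ sym (ℕₚ.*-distribˡ-∸ 2 (2 ^ n) (length P₀)) ⟩
      2 * (2 ^ n ∸ length P₀) ∎)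
    where open ≡-Reasoning

  A₀ : List (W × W)
  A₀ = pairUp X₀

  unpair-A₀ : unpair A₀ ≡ X₀
  unpair-A₀ = unpair-pairUp (proj₁ X₀-even) X₀ (proj₂ X₀-even)

  P₀++A₀-pairing : IsPairing (P₀ ++ A₀)
  P₀++A₀-pairing = mkPairing
    (subst Unique (sym unpair-P₀++A₀) (Unique-halfVertices P-pairing false))
    (λ w → subst (w ∈_) (sym unpair-P₀++A₀) (∈-halfVertices P-pairing false w))
    where
    unpair-P₀++A₀ : unpair (P₀ ++ A₀) ≡ unpair P₀ ++ X₀
    unpair-P₀++A₀ = trans (unpair-++ P₀ A₀) (cong (unpair P₀ ++_) unpair-A₀)

  ∈±A₀⇒∈X₀ : ∀ {q z} → q ∈± A₀ → z ∈ₚ q → z ∈ X₀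
  ∈±A₀⇒∈X₀ q∈A₀ z∈q = subst (_ ∈_) unpair-A₀ (∈±-unpair⁺ q∈A₀ z∈q)

  -- X₀ is nonempty since (x₀ , y₀) crosses, so the cycle can be rotated to start with a pair of A₀.
  cycle₀ : ∃[ q ] q ∈± A₀ × ∃[ l ] IsAltHamCycle (P₀ ++ A₀) (q ∷ l)
  cycle₀ with fink-IH (P₀ ++ A₀) P₀++A₀-pairing
  ... | C , C-cycle with crossing-nonempty P xy₀∈P xy₀-crosses
  ... | c , c∈X with ∈-unpair⁻ C (IsPairing.spanning (IsAltHamCycle.pairing C-cycle) (proj₁ c))
  ... | q , q∈C , c₀∈q = q , q∈A₀ , IsAltHamCycle-rotate C-cycle q∈C
    where
    q∈A₀ : q ∈± A₀
    q∈A₀ with ∈±-++⁻ P₀ (All.lookup (IsAltHamCycle.⊆±P C-cycle) q∈C)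
    ... | inj₂ q∈A₀ = q∈A₀
    ... | inj₁ q∈P₀ = ⊥-elim (P₀∌X₀ (∈±-unpair⁺ q∈P₀ c₀∈q) (∈-map⁺ proj₁ c∈X))

  partner : W → W
  partner = associate X

  partner-∈ : ∀ {x} → x ∈ X₀ → (x , partner x) ∈ X
  partner-∈ = associate-∈ X

  partner-injective : ∀ {x x'} → x ∈ X₀ → x' ∈ X₀ → partner x ≡ partner x' → x ≡ x'
  partner-injective x∈ x'∈ eq = cong proj₁ (Unique-map⇒injective proj₂ Unique-X₁ (partner-∈ x∈) (partner-∈ x'∈) eq)

  partner-≡ : ∀ {x w} → (x , w) ∈ X → partner x ≡ w
  partner-≡ c∈ = cong proj₂ (Unique-map⇒injective proj₁ Unique-X₀ (partner-∈ (∈-map⁺ proj₁ c∈)) c∈ refl)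

  partner-∈X₁ : ∀ {x} → x ∈ X₀ → partner x ∈ X₁
  partner-∈X₁ x∈ = ∈-map⁺ proj₂ (partner-∈ x∈)

  lift-partner : ∀ {x} → x ∈ X₀ → (lift₀ x , lift₁ (partner x)) ∈± P
  lift-partner x∈ = crossing-lift P (partner-∈ x∈)

  -- (s , S , e) is a stretch of a cycle in the 0-half, from s through the pairs S to e.
  Segment : Set
  Segment = W × List (W × W) × W

  segmentVertices : Segment → List W
  segmentVertices (s , S , e) = s ∷ unpair S ++ [ e ]

  segmentEnds : Segment → List W
  segmentEnds (s , S , e) = s ∷ e ∷ []

  segmentPair : Segment → W × W
  segmentPair (s , S , e) = partner s , partner e

  reverseSegment : Segment → Segment
  reverseSegment (s , S , e) = e , map swap (reverse S) , s

  data Direction : Set where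
    forward backward : Direction

  orient : Direction → Segment → Segment
  orient forward σ = σ
  orient backward σ = reverseSegment σ

  segmentVertices-reverse : ∀ σ → segmentVertices (reverseSegment σ) ≡ reverse (segmentVertices σ)
  segmentVertices-reverse (s , S , e) = begin
      e ∷ unpair (map swap (reverse S)) ++ [ s ]
    ≡⟨ cong (λ l → e ∷ l ++ [ s ]) (unpair-reverse S) ⟩
      e ∷ reverse (unpair S) ++ [ s ]
    ≡⟨ cong (_++ [ s ]) (sym (reverse-++ (unpair S) [ e ])) ⟩
      reverse (unpair S ++ [ e ]) ++ [ s ]
    ≡⟨ sym (unfold-reverse s (unpair S ++ [ e ])) ⟩
      reverse (s ∷ unpair S ++ [ e ]) ∎
    where open ≡-Reasoning

  cut : W → List (W × W) → List (W × W) → W → List Segment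
  cut s acc [] e = (s , acc , e) ∷ []
  cut s acc (p ∷ r) e with p ∈±? A₀
  ... | yes _ = (s , acc , proj₁ p) ∷ cut (proj₂ p) [] r e
  ... | no _ = cut s (acc ++ p ∷ []) r e

  cut-vertices : ∀ s acc r e → concatMap segmentVertices (cut s acc r e) ≡ s ∷ unpair acc ++ unpair r ++ [ e ]
  cut-vertices s acc [] e = cong (s ∷_) (++-identityʳ (unpair acc ++ [ e ]))
  cut-vertices s acc ((a , b) ∷ r) e with (a , b) ∈±? A₀
  ... | yes _ = cong (s ∷_) (trans (cong ((unpair acc ++ [ a ]) ++_) (cut-vertices b [] r e)) (++-assoc (unpair acc) [ a ] _))
  ... | no _ = trans (cut-vertices s (acc ++ (a , b) ∷ []) r e)
      (cong (s ∷_) (trans (cong (_++ unpair r ++ [ e ]) (unpair-++ acc ((a , b) ∷ []))) (++-assoc (unpair acc) (a ∷ b ∷ []) _)))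

  LinkedSegment : Segment → Set
  LinkedSegment (s , S , e) = Linked Adj s S e

  cut-linked : ∀ s acc r e → Linked Adj s (acc ++ r) e → All LinkedSegment (cut s acc r e)
  cut-linked s acc [] e c = subst (λ l → Linked Adj s l e) (++-identityʳ acc) c ∷ []
  cut-linked s acc ((a , b) ∷ r) e c with (a , b) ∈±? A₀
  ... | yes _ = proj₁ (Linked-++⁻ acc r c) ∷ cut-linked b [] r e (proj₂ (Linked-++⁻ acc r c))
  ... | no _ = cut-linked s (acc ++ (a , b) ∷ []) r e (subst (λ l → Linked Adj s l e) (sym (++-assoc acc ((a , b) ∷ []) r)) c)

  LinkedSegment-reverse : ∀ {σ} → LinkedSegment σ → LinkedSegment (reverseSegment σ)
  LinkedSegment-reverse {s , S , e} = Linked-reverse (λ {x} {y} → Adj-sym {u = x} {y}) S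

  InnerSegment : Segment → Set
  InnerSegment (s , S , e) = All (_∈± P₀) S

  cut-inner : ∀ s acc r e → All (_∈± P₀) acc → All (λ p → ¬ p ∈± A₀ → p ∈± P₀) r → All InnerSegment (cut s acc r e)
  cut-inner s acc [] e acc⊆ _ = acc⊆ ∷ []
  cut-inner s acc (p ∷ r) e acc⊆ (p∈ ∷ r⊆) with p ∈±? A₀
  ... | yes _ = acc⊆ ∷ cut-inner (proj₂ p) [] r e [] r⊆
  ... | no p∉A₀ = cut-inner s (acc ++ p ∷ []) r e (Allₚ.++⁺ acc⊆ (p∈ p∉A₀ ∷ [])) r⊆

  InnerSegment-reverse : ∀ {σ} → InnerSegment σ → InnerSegment (reverseSegment σ)
  InnerSegment-reverse {s , S , e} S⊆ = Allₚ.map⁺ (All.map ∈±-swap (↭ₚ.All-resp-↭ (↭-sym (↭ₚ.↭-reverse S)) S⊆))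

  EndsInX₀ : Segment → Set
  EndsInX₀ (s , S , e) = s ∈ X₀ × e ∈ X₀

  cut-ends : ∀ s acc r e → s ∈ X₀ → e ∈ X₀ → All EndsInX₀ (cut s acc r e)
  cut-ends s acc [] e s∈ e∈ = (s∈ , e∈) ∷ []
  cut-ends s acc (p ∷ r) e s∈ e∈ with p ∈±? A₀
  ... | yes p∈A₀ = (s∈ , ∈±A₀⇒∈X₀ p∈A₀ (inj₁ refl)) ∷ cut-ends (proj₂ p) [] r e (∈±A₀⇒∈X₀ p∈A₀ (inj₂ refl)) e∈
  ... | no _ = cut-ends s (acc ++ p ∷ []) r e s∈ e∈

  module Segments (q : W × W) (q∈A₀ : q ∈± A₀) (l : List (W × W)) (C₀ : IsAltHamCycle (P₀ ++ A₀) (q ∷ l)) where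
    open IsAltHamCycle C₀

    segments : List Segment
    segments = cut (proj₂ q) [] l (proj₁ q)

    segmentVertices-↭ : concatMap segmentVertices segments ↭ unpair (q ∷ l)
    segmentVertices-↭ rewrite cut-vertices (proj₂ q) [] l (proj₁ q) = ↭ₚ.++-comm (proj₂ q ∷ unpair l) [ proj₁ q ]

    Unique-segmentVertices : Unique (concatMap segmentVertices segments)
    Unique-segmentVertices = Unique-resp-↭ (↭-sym segmentVertices-↭) (IsPairing.unique pairing)

    ∈-segmentVertices : ∀ w → w ∈ concatMap segmentVertices segments
    ∈-segmentVertices w = ↭ₚ.∈-resp-↭ (↭-sym segmentVertices-↭) (IsPairing.spanning pairing w)

    segments-unique : All (λ σ → Unique (segmentVertices σ)) segments
    segments-unique = Allₚ.map⁻ (proj₁ (Unique-concat⁻ (map segmentVertices segments) Unique-segmentVertices))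

    segments-disjoint : AllPairs (λ σ σ' → DisjointLists (segmentVertices σ) (segmentVertices σ')) segments
    segments-disjoint = AllPairsₚ.map⁻ (proj₂ (Unique-concat⁻ (map segmentVertices segments) Unique-segmentVertices))

    segments-linked : All LinkedSegment segments
    segments-linked = cut-linked (proj₂ q) [] l (proj₁ q) cyclic

    segments-inner : All InnerSegment segments
    segments-inner = cut-inner (proj₂ q) [] l (proj₁ q) [] (All.map outside-A₀ (All.tail ⊆±P))
      where
      outside-A₀ : ∀ {p} → p ∈± (P₀ ++ A₀) → ¬ p ∈± A₀ → p ∈± P₀
      outside-A₀ p∈ p∉A₀ with ∈±-++⁻ P₀ p∈
      ... | inj₁ p∈P₀ = p∈P₀
      ... | inj₂ p∈A₀ = ⊥-elim (p∉A₀ p∈A₀)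

    segments-ends : All EndsInX₀ segments
    segments-ends = cut-ends (proj₂ q) [] l (proj₁ q) (∈±A₀⇒∈X₀ q∈A₀ (inj₂ refl)) (∈±A₀⇒∈X₀ q∈A₀ (inj₁ refl))

    E : List W
    E = concatMap segmentEnds segments

    E⊆X₀ : ∀ {z} → z ∈ E → z ∈ X₀
    E⊆X₀ z∈ with find (∈-concatMap⁻ segmentEnds z∈)
    ... | σ , σ∈ , here refl = proj₁ (All.lookup segments-ends σ∈)
    ... | σ , σ∈ , there (here refl) = proj₂ (All.lookup segments-ends σ∈)

    X₀⊆E : ∀ {z} → z ∈ X₀ → z ∈ E
    X₀⊆E {z} z∈X₀ with find (∈-concatMap⁻ segmentVertices (∈-segmentVertices z))
    ... | σ , σ∈ , here refl = ∈-concatMap⁺ segmentEnds (Any.map (λ { refl → here refl }) σ∈)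
    ... | σ@(s , S , e) , σ∈ , there z∈ with ∈-++⁻ (unpair S) z∈
    ...   | inj₂ (here refl) = ∈-concatMap⁺ segmentEnds (Any.map (λ { refl → there (here refl) }) σ∈)
    ...   | inj₁ z∈S with ∈-unpair⁻ S z∈S
    ...     | p , p∈S , z∈p = ⊥-elim (P₀∌X₀ (∈±-unpair⁺ (All.lookup (All.lookup segments-inner σ∈) p∈S) z∈p) z∈X₀)

    Unique-E : Unique E
    Unique-E = Unique-concat⁺ (Allₚ.map⁺ (All.map ends-unique segments-unique)) (AllPairsₚ.map⁺ (AllPairs.map ends-disjoint segments-disjoint))
      where
      ends⊆vertices : ∀ {σ z} → z ∈ segmentEnds σ → z ∈ segmentVertices σ
      ends⊆vertices {s , S , e} (here refl) = here refl
      ends⊆vertices {s , S , e} (there (here refl)) = there (∈-++⁺ʳ (unpair S) (here refl))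
      ends-unique : ∀ {σ} → Unique (segmentVertices σ) → Unique (segmentEnds σ)
      ends-unique {s , S , e} (s∉ ∷ _) = (All.lookup s∉ (∈-++⁺ʳ (unpair S) (here refl)) ∷ []) ∷ [] ∷ []
      ends-disjoint : ∀ {σ σ'} → DisjointLists (segmentVertices σ) (segmentVertices σ') → DisjointLists (segmentEnds σ) (segmentEnds σ')
      ends-disjoint d z∈ z∈' = d (ends⊆vertices z∈) (ends⊆vertices z∈')

    B₁ : List (W × W)
    B₁ = map segmentPair segments

    unpair-P₁++B₁ : unpair (P₁ ++ B₁) ≡ unpair P₁ ++ map partner E
    unpair-P₁++B₁ = trans (unpair-++ P₁ B₁) (cong (unpair P₁ ++_) (go segments))
      where
      go : ∀ σs → unpair (map segmentPair σs) ≡ map partner (concatMap segmentEnds σs)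
      go [] = refl
      go ((s , S , e) ∷ σs) = cong (λ r → partner s ∷ partner e ∷ r) (go σs)

    P₁++B₁-pairing : IsPairing (P₁ ++ B₁)
    P₁++B₁-pairing = mkPairing (subst Unique (sym unpair-P₁++B₁) unique) (λ w → subst (w ∈_) (sym unpair-P₁++B₁) (spanning w))
      where
      unique : Unique (unpair P₁ ++ map partner E)
      unique = Uniqueₚ.++⁺ (Unique-++⁻ˡ (unpair P₁) (Unique-halfVertices P-pairing true))
        (Unique-map⁺-on partner E Unique-E (λ x∈ y∈ → partner-injective (E⊆X₀ x∈) (E⊆X₀ y∈)))
        λ (z∈P₁ , z∈pE) → let x , x∈E , z≡ = ∈-map⁻ partner z∈pE in P₁∌X₁ z∈P₁ (subst (_∈ X₁) (sym z≡) (partner-∈X₁ (E⊆X₀ x∈E)))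
      spanning : ∀ w → w ∈ unpair P₁ ++ map partner E
      spanning w with ∈-++⁻ (unpair P₁) (∈-halfVertices P-pairing true w)
      ... | inj₁ w∈P₁ = ∈-++⁺ˡ w∈P₁
      ... | inj₂ w∈X₁ with ∈-map⁻ proj₂ w∈X₁
      ...   | (x , w') , c∈X , refl = ∈-++⁺ʳ (unpair P₁) (subst (_∈ map partner E) (partner-≡ c∈X) (∈-map⁺ partner (X₀⊆E (∈-map⁺ proj₁ c∈X))))

    same-segment : ∀ {σ σ' z} → σ ∈ segments → σ' ∈ segments → z ∈ segmentVertices σ → z ∈ segmentVertices σ' → σ ≡ σ'
    same-segment σ∈ σ'∈ = Unique-concatMap⇒≡ segmentVertices segments Unique-segmentVertices σ∈ σ'∈

    record SegmentBetween (u v : W) : Set where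
      constructor segmentBetween
      field
        original : Segment
        original∈ : original ∈ segments
        direction : Direction
        pair≡ : segmentPair (orient direction original) ≡ (u , v)

      oriented : Segment
      oriented = orient direction original

      linked : LinkedSegment oriented
      linked with direction
      ... | forward = All.lookup segments-linked original∈
      ... | backward = LinkedSegment-reverse {original} (All.lookup segments-linked original∈)

      inside : InnerSegment oriented
      inside with direction
      ... | forward = All.lookup segments-inner original∈
      ... | backward = InnerSegment-reverse {original} (All.lookup segments-inner original∈)

      ends : EndsInX₀ oriented
      ends with direction
      ... | forward = All.lookup segments-ends original∈
      ... | backward = swap (All.lookup segments-ends original∈)

      vertices-↭ : segmentVertices oriented ↭ segmentVertices original
      vertices-↭ with direction
      ... | forward = ↭.refl
      ... | backward = subst (_↭ segmentVertices original) (sym (segmentVertices-reverse original)) (↭ₚ.↭-reverse (segmentVertices original))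

      pair-⊆ : ∀ {z} → z ∈ₚ segmentPair original → z ∈ₚ (u , v)
      pair-⊆ {z} z∈ = subst (z ∈ₚ_) pair≡ (reoriented direction)
        where
        reoriented : ∀ d → z ∈ₚ segmentPair (orient d original)
        reoriented forward = z∈
        reoriented backward = Sum.swap z∈

      pair-⊇ : ∀ {z} → z ∈ₚ (u , v) → z ∈ₚ segmentPair original
      pair-⊇ {z} z∈ = unoriented direction (subst (z ∈ₚ_) (sym pair≡) z∈)
        where
        unoriented : ∀ d → z ∈ₚ segmentPair (orient d original) → z ∈ₚ segmentPair original
        unoriented forward z∈ = z∈
        unoriented backward z∈ = Sum.swap z∈

    Classified : W × W → Set
    Classified (u , v) = (u , v) ∈± P₁ ⊎ SegmentBetween u v

    classify : ∀ {p} → p ∈± (P₁ ++ B₁) → Classified p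
    classify p∈ with ∈±-++⁻ P₁ p∈
    ... | inj₁ p∈P₁ = inj₁ p∈P₁
    ... | inj₂ (inj₁ p∈B₁) with ∈-map⁻ segmentPair p∈B₁
    ...   | σ , σ∈ , refl = inj₂ (segmentBetween σ σ∈ forward refl)
    classify p∈ | inj₂ (inj₂ p∈B₁) with ∈-map⁻ segmentPair p∈B₁
    ...   | σ , σ∈ , eq = inj₂ (segmentBetween σ σ∈ backward (cong swap (sym eq)))

    partner-end⇒same-segment : ∀ {σ σ'} → σ ∈ segments → σ' ∈ segments → partner (proj₁ σ) ∈ₚ segmentPair σ' → σ ≡ σ'
    partner-end⇒same-segment {s , S , e} {s' , S' , e'} σ∈ σ'∈ (inj₁ eq) =
      same-segment σ∈ σ'∈ (here refl) (here (partner-injective (proj₁ (All.lookup segments-ends σ∈)) (proj₁ (All.lookup segments-ends σ'∈)) eq))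
    partner-end⇒same-segment {s , S , e} {s' , S' , e'} σ∈ σ'∈ (inj₂ eq) =
      same-segment σ∈ σ'∈ (here refl)
        (there (∈-++⁺ʳ (unpair S') (here (partner-injective (proj₁ (All.lookup segments-ends σ∈)) (proj₂ (All.lookup segments-ends σ'∈)) eq))))

    segmentBlock : W → Segment → W → List (U × U)
    segmentBlock u (s , S , e) v = (lift₁ u , lift₀ s) ∷ map (both lift₀) S ++ (lift₀ e , lift₁ v) ∷ []

    block : ∀ {u v} → Classified (u , v) → List (U × U)
    block {u} {v} (inj₁ _) = (lift₁ u , lift₁ v) ∷ []
    block {u} {v} (inj₂ sb) = segmentBlock u (SegmentBetween.oriented sb) v

    expand : ∀ {C} → All Classified C → List (U × U)
    expand [] = []
    expand (c ∷ cs) = block c ++ expand cs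

    middle : ∀ {u v} → Classified (u , v) → List W
    middle (inj₁ _) = []
    middle (inj₂ sb) = segmentVertices (SegmentBetween.oriented sb)

    unpair-segmentBlock : ∀ u σ v → unpair (segmentBlock u σ v) ≡ lift₁ u ∷ map lift₀ (segmentVertices σ) ++ [ lift₁ v ]
    unpair-segmentBlock u (s , S , e) v = cong (λ l → lift₁ u ∷ lift₀ s ∷ l) (begin
        unpair (map (both lift₀) S ++ (lift₀ e , lift₁ v) ∷ [])
      ≡⟨ unpair-++ (map (both lift₀) S) _ ⟩
        unpair (map (both lift₀) S) ++ lift₀ e ∷ lift₁ v ∷ []
      ≡⟨ cong (_++ lift₀ e ∷ lift₁ v ∷ []) (unpair-map lift₀ S) ⟩
        map lift₀ (unpair S) ++ lift₀ e ∷ lift₁ v ∷ []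
      ≡⟨ sym (++-assoc (map lift₀ (unpair S)) [ lift₀ e ] [ lift₁ v ]) ⟩
        (map lift₀ (unpair S) ++ [ lift₀ e ]) ++ [ lift₁ v ]
      ≡⟨ cong (_++ [ lift₁ v ]) (sym (map-++ lift₀ (unpair S) [ e ])) ⟩
        map lift₀ (unpair S ++ [ e ]) ++ [ lift₁ v ] ∎)
      where open ≡-Reasoning

    unpair-block : ∀ {u v} (c : Classified (u , v)) → unpair (block c) ≡ lift₁ u ∷ map lift₀ (middle c) ++ [ lift₁ v ]
    unpair-block (inj₁ _) = refl
    unpair-block {u} {v} (inj₂ sb) = unpair-segmentBlock u (SegmentBetween.oriented sb) v

    block-linked : ∀ {u v} (c : Classified (u , v)) → ∃[ b ] ∃[ m ] block c ≡ (lift₁ u , b) ∷ m × LinkedUntil Adj b m (lift₁ v)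
    block-linked (inj₁ _) = _ , [] , refl , refl
    block-linked {u} {v} (inj₂ sb) = segment (SegmentBetween.oriented sb) (SegmentBetween.linked sb)
      where
      segment : ∀ σ → LinkedSegment σ → ∃[ b ] ∃[ m ] segmentBlock u σ v ≡ (lift₁ u , b) ∷ m × LinkedUntil Adj b m (lift₁ v)
      segment (s , S , e) linked = lift₀ s , _ , refl , Linked-∷ʳ (map (both lift₀) S) (Linked-map lift₀ (Adj-lift false) S linked)

    expand-linked : ∀ {v₀ w C} (cs : All Classified C) → Linked Adj v₀ C w → Linked Adj (lift₁ v₀) (expand cs) (lift₁ w)
    expand-linked [] ad = Adj-lift true ad
    expand-linked (c ∷ cs) (ad , rest) with block-linked c
    ... | b , m , eq , until rewrite eq = Adj-lift true ad , LinkedUntil-++ m (expand cs) until (expand-linked cs rest)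

    expand-cyclic : ∀ {C} (cs : All Classified C) → Cyclic Adj C → Cyclic Adj (expand cs)
    expand-cyclic (c ∷ cs) cyc with block-linked c
    ... | b , m , eq , until rewrite eq = LinkedUntil-++ m (expand cs) until (expand-linked cs cyc)

    ∈±-lift : ∀ b {q} → q ∈± inner b P → both (lift b) q ∈± P
    ∈±-lift b (inj₁ q∈) = inj₁ (inner-lift b P q∈)
    ∈±-lift b (inj₂ q∈) = inj₂ (inner-lift b P q∈)

    block-⊆± : ∀ {u v} (c : Classified (u , v)) → All (_∈± P) (block c)
    block-⊆± (inj₁ uv∈P₁) = ∈±-lift true uv∈P₁ ∷ []
    block-⊆± (inj₂ sb) = segment (SegmentBetween.oriented sb) (SegmentBetween.pair≡ sb) (SegmentBetween.inside sb) (SegmentBetween.ends sb)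
      where
      segment : ∀ {u v} σ → segmentPair σ ≡ (u , v) → InnerSegment σ → EndsInX₀ σ → All (_∈± P) (segmentBlock u σ v)
      segment (s , S , e) refl S⊆ (s∈ , e∈) =
        ∈±-swap (lift-partner s∈) ∷ Allₚ.++⁺ (Allₚ.map⁺ (All.map (∈±-lift false) S⊆)) (lift-partner e∈ ∷ [])

    expand-⊆± : ∀ {C} (cs : All Classified C) → All (_∈± P) (expand cs)
    expand-⊆± [] = []
    expand-⊆± (c ∷ cs) = Allₚ.++⁺ (block-⊆± c) (expand-⊆± cs)

    ∈-expand⁺ : ∀ {C} (cs : All Classified C) {p z} (p∈ : p ∈ C) → z ∈ unpair (block (All.lookup cs p∈)) → z ∈ unpair (expand cs)
    ∈-expand⁺ (c ∷ cs) (here refl) z∈ rewrite unpair-++ (block c) (expand cs) = ∈-++⁺ˡ z∈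
    ∈-expand⁺ (c ∷ cs) (there p∈) z∈ rewrite unpair-++ (block c) (expand cs) = ∈-++⁺ʳ (unpair (block c)) (∈-expand⁺ cs p∈ z∈)

    ∈-block-end : ∀ {u v z} (c : Classified (u , v)) → z ∈ₚ (u , v) → lift₁ z ∈ unpair (block c)
    ∈-block-end c z∈ rewrite unpair-block c with z∈
    ... | inj₁ refl = here refl
    ... | inj₂ refl = there (∈-++⁺ʳ _ (here refl))

    ∈-block-middle : ∀ {u v z} (c : Classified (u , v)) → z ∈ middle c → lift₀ z ∈ unpair (block c)
    ∈-block-middle c z∈ rewrite unpair-block c = there (∈-++⁺ˡ (∈-map⁺ lift₀ z∈))

    ∈-block⁻ : ∀ {u v z} (c : Classified (u , v)) → z ∈ unpair (block c) →
               (∃[ w ] z ≡ lift₁ w × w ∈ₚ (u , v)) ⊎ (∃[ w ] z ≡ lift₀ w × w ∈ middle c)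
    ∈-block⁻ c z∈ rewrite unpair-block c with z∈
    ... | here refl = inj₁ (_ , refl , inj₁ refl)
    ... | there z∈' with ∈-++⁻ (map lift₀ (middle c)) z∈'
    ...   | inj₁ z∈m = let w , w∈ , z≡ = ∈-map⁻ lift₀ z∈m in inj₂ (w , z≡ , w∈)
    ...   | inj₂ (here refl) = inj₁ (_ , refl , inj₂ refl)

    middle-unique : ∀ {u v} (c : Classified (u , v)) → Unique (middle c)
    middle-unique (inj₁ _) = []
    middle-unique (inj₂ sb) = Unique-resp-↭ (↭-sym (SegmentBetween.vertices-↭ sb))
      (All.lookup segments-unique (SegmentBetween.original∈ sb))

    block-unique : ∀ {u v} (c : Classified (u , v)) → u ≢ v → Unique (unpair (block c))
    block-unique {u} {v} c u≢v rewrite unpair-block c =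
      Allₚ.++⁺ (Allₚ.map⁺ (All.tabulate (λ _ eq → lift-false≢lift-true (sym eq)))) ((λ eq → u≢v (lift-injective eq)) ∷ []) ∷
      Uniqueₚ.++⁺ (Uniqueₚ.map⁺ lift-injective (middle-unique c)) ([] ∷ [])
        (λ (z∈m , z∈v) → let w , _ , z≡ = ∈-map⁻ lift₀ z∈m in lift-false≢lift-true (trans (sym z≡) (Anyₚ.singleton⁻ z∈v)))

    block-disjoint : ∀ {u v u' v'} (c : Classified (u , v)) (c' : Classified (u' , v')) →
                     Disjointₚ (u , v) (u' , v') → DisjointLists (unpair (block c)) (unpair (block c'))
    block-disjoint c c' apart z∈ z∈' with ∈-block⁻ c z∈ | ∈-block⁻ c' z∈'
    ... | inj₁ (w , refl , w∈) | inj₁ (w' , eq , w'∈) = apart w w∈ (subst (_∈ₚ _) (sym (lift-injective eq)) w'∈)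
    ... | inj₁ (w , refl , _) | inj₂ (w' , eq , _) = lift-false≢lift-true (sym eq)
    ... | inj₂ (w , refl , _) | inj₁ (w' , eq , _) = lift-false≢lift-true eq
    block-disjoint {u} (inj₂ sb) (inj₂ sb') apart z∈ z∈' | inj₂ (w , refl , w∈) | inj₂ (w' , eq , w'∈)
      with same-segment (SegmentBetween.original∈ sb) (SegmentBetween.original∈ sb')
             (↭ₚ.∈-resp-↭ (SegmentBetween.vertices-↭ sb) w∈)
             (↭ₚ.∈-resp-↭ (SegmentBetween.vertices-↭ sb') (subst (_∈ _) (sym (lift-injective eq)) w'∈))
    ... | same = apart u (inj₁ refl) (SegmentBetween.pair-⊆ sb' (subst (λ σ → u ∈ₚ segmentPair σ) same (SegmentBetween.pair-⊇ sb (inj₁ refl))))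

    disjoint-expand : ∀ {u v C} (c : Classified (u , v)) (cs : All Classified C) →
                      All (Disjointₚ (u , v)) C → DisjointLists (unpair (block c)) (unpair (expand cs))
    disjoint-expand c (c' ∷ cs) (apart ∷ aparts) z∈ z∈' rewrite unpair-++ (block c') (expand cs) with ∈-++⁻ (unpair (block c')) z∈'
    ... | inj₁ z∈c' = block-disjoint c c' apart z∈ z∈c'
    ... | inj₂ z∈cs = disjoint-expand c cs aparts z∈ z∈cs

    expand-unique : ∀ {C} (cs : All Classified C) → All Distinctₚ C → AllPairs Disjointₚ C → Unique (unpair (expand cs))
    expand-unique [] [] [] = []
    expand-unique (c ∷ cs) (distinct ∷ distincts) (aparts ∷ disjoint) = subst Unique (sym (unpair-++ (block c) (expand cs)))
      (Uniqueₚ.++⁺ (block-unique c distinct) (expand-unique cs distincts disjoint) (λ (z∈ , z∈') → disjoint-expand c cs aparts z∈ z∈'))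

    module _ {C₁} (C₁-cycle : IsAltHamCycle (P₁ ++ B₁) C₁) where
      open IsAltHamCycle C₁-cycle renaming (pairing to C₁-pairing; ⊆±P to C₁⊆±; cyclic to C₁-cyclic)

      classified : All Classified C₁
      classified = All.map classify C₁⊆±

      expand-spanning : ∀ v → v ∈ unpair (expand classified)
      expand-spanning v with lookup v t in v∈
      ... | true with ∈-unpair⁻ C₁ (IsPairing.spanning C₁-pairing (drop v))
      ...   | p , p∈ , dv∈p = subst (_∈ _) (lift-drop v v∈) (∈-expand⁺ classified p∈ (∈-block-end (All.lookup classified p∈) dv∈p))
      -- A vertex of the 0-half lies on a segment σ, and the pair of the cycle containing the partner
      -- of the start of σ is the pair of σ, whose block contains σ.
      expand-spanning v | false with find (∈-concatMap⁻ segmentVertices (∈-segmentVertices (drop v)))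
      ... | σ , σ∈ , dv∈σ with ∈-unpair⁻ C₁ (IsPairing.spanning C₁-pairing (partner (proj₁ σ)))
      ... | p , p∈ , s∈p = subst (_∈ _) (lift-drop v v∈) (∈-expand⁺ classified p∈ (in-block (All.lookup classified p∈)))
        where
        s∈X₀ : proj₁ σ ∈ X₀
        s∈X₀ = proj₁ (All.lookup segments-ends σ∈)
        in-block : (c : Classified p) → lift₀ (drop v) ∈ unpair (block c)
        in-block (inj₁ p∈P₁) = ⊥-elim (P₁∌X₁ (∈±-unpair⁺ p∈P₁ s∈p) (partner-∈X₁ s∈X₀))
        in-block (inj₂ sb) with partner-end⇒same-segment σ∈ (SegmentBetween.original∈ sb) (SegmentBetween.pair-⊇ sb s∈p)
        ... | refl = ∈-block-middle (inj₂ sb) (↭ₚ.∈-resp-↭ (↭-sym (SegmentBetween.vertices-↭ sb)) dv∈σ)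

      extended : ∃[ C ] IsAltHamCycle P C
      extended with Unique-unpair⁻ C₁ (IsPairing.unique C₁-pairing)
      ... | distinct , disjoint = expand classified , mkAltHamCycle
        (mkPairing (expand-unique classified distinct disjoint) expand-spanning) (expand-⊆± classified) (expand-cyclic classified C₁-cyclic)

    cycle : ∃[ C ] IsAltHamCycle P C
    cycle = extended (proj₂ (fink-IH (P₁ ++ B₁) P₁++B₁-pairing))

  cycle : ∃[ C ] IsAltHamCycle P C
  cycle = let q , q∈A₀ , l , C₀ = cycle₀ in Segments.cycle q q∈A₀ l C₀

fink : ∀ n → FinkProperty (suc n)
fink zero = fink-one
fink (suc n) [] (mkPairing _ spanning) with spanning (Vec.replicate _ false)
... | ()
fink (suc n) P@((x , y) ∷ _) P-pairing@(mkPairing ((x≢y ∷ _) ∷ _) _) with differingCoordinate x≢y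
... | t , differ = FinkStep.cycle (fink n) t P P-pairing (here refl) differ

-- Hamilton paths through a matching

IsWalk⇒Walk : ∀ {n} (p : List (V n)) {u v} → IsWalk p → head p ≡ just u → last p ≡ just v → ∃[ l ] p ≡ u ∷ l × Walk Adj u l v
IsWalk⇒Walk (x ∷ []) _ refl refl = [] , refl , refl
IsWalk⇒Walk (x ∷ y ∷ p) (ad , w) refl eq with IsWalk⇒Walk (y ∷ p) w refl eq
... | l , refl , walk = y ∷ p , refl , ad , walk

Walk⇒IsWalk : ∀ {n} {u v : V n} l → Walk Adj u l v → IsWalk (u ∷ l)
Walk⇒IsWalk [] refl = tt
Walk⇒IsWalk (y ∷ l) (ad , w) = ad , Walk⇒IsWalk l w

EdgeOf⇒Consecutive : ∀ {n} (f : Edge n) p → EdgeOf f p → Consecutive (proj₁ f) (proj₂ f) p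
EdgeOf⇒Consecutive f (x ∷ y ∷ p) (inj₁ e) = inj₁ e
EdgeOf⇒Consecutive f (x ∷ y ∷ p) (inj₂ e) = inj₂ (EdgeOf⇒Consecutive f (y ∷ p) e)

Consecutive⇒EdgeOf : ∀ {n} (f : Edge n) p → Consecutive (proj₁ f) (proj₂ f) p → EdgeOf f p
Consecutive⇒EdgeOf f (x ∷ y ∷ p) (inj₁ e) = inj₁ e
Consecutive⇒EdgeOf f (x ∷ y ∷ p) (inj₂ e) = inj₂ (Consecutive⇒EdgeOf f (y ∷ p) e)

ContainsEdges : List (A × A) → List A → Set
ContainsEdges M L = All (λ (a , b) → Consecutive a b L) M

record IsHamPath (R : A → A → Set) (Contains : List A → Set) (u : A) (l : List A) (v : A) : Set where
  constructor hamPath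
  field
    unique : Unique (u ∷ l)
    spanning : ∀ w → w ∈ u ∷ l
    walk : Walk R u l v
    contains : Contains (u ∷ l)

PathProperty⇒IsHamPath : ∀ {d} → PathProperty d → ∀ M → IsMatching M → ∀ u v → OppositeParity u v → ¬ Covered u M →
                         ∃[ l ] IsHamPath Adj (ContainsEdges M) u l v
PathProperty⇒IsHamPath pp M M-matching u v opposite uncovered with pp M M-matching u v opposite uncovered
... | p , ((unique , spanning) , isWalk , p-head , p-last) , contains with IsWalk⇒Walk p isWalk p-head p-last
... | l , refl , walk = l , hamPath unique spanning walk (All.map (λ {f} → EdgeOf⇒Consecutive f (u ∷ l)) contains)

Endpoint? : ∀ {n} (w : V n) (f : Edge n) → Dec (Endpoint w f)
Endpoint? w (a , b) with w ≟V a | w ≟V b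
... | yes w≡a | _ = yes (inj₁ w≡a)
... | no _ | yes w≡b = yes (inj₂ w≡b)
... | no w≢a | no w≢b = no λ { (inj₁ w≡a) → w≢a w≡a ; (inj₂ w≡b) → w≢b w≡b }

Covered? : ∀ {n} (w : V n) (M : List (Edge n)) → Dec (Covered w M)
Covered? w M = Any.any? (Endpoint? w) M

matching-edge-unique : ∀ {n} {M : List (Edge n)} {f g z} → AllPairs Disjoint M → f ∈ M → g ∈ M → Endpoint z f → Endpoint z g → f ≡ g
matching-edge-unique {f = f} {g} {z} disjoint f∈ g∈ z∈f z∈g with f ≟E g
... | yes f≡g = f≡g
... | no f≢g with AllPairs-∈ disjoint f∈ g∈ f≢g
...   | inj₁ apart = ⊥-elim (apart z z∈f z∈g)
...   | inj₂ apart = ⊥-elim (apart z z∈g z∈f)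

Consecutive-∷⁻ : ∀ {a b x : A} xs → a ≢ x → b ≢ x → Consecutive a b (x ∷ xs) → Consecutive a b xs
Consecutive-∷⁻ (y ∷ xs) a≢x _ (inj₁ (inj₁ (x≡a , _))) = ⊥-elim (a≢x (sym x≡a))
Consecutive-∷⁻ (y ∷ xs) _ b≢x (inj₁ (inj₂ (x≡b , _))) = ⊥-elim (b≢x (sym x≡b))
Consecutive-∷⁻ (y ∷ xs) _ _ (inj₂ p) = p

matchedNeighbour : ∀ {n} (M : List (Edge (suc n))) → IsMatching M → ∀ e →
                   ∃[ e' ] Adj e' e × (∀ {g} → g ∈ M → Endpoint e g → Consecutive (proj₁ g) (proj₂ g) (e' ∷ e ∷ []))
matchedNeighbour M (edges , disjoint) e with Covered? e M
... | no uncovered = flipHead e , Adj-sym {u = e} {flipHead e} (Adj-flipHead e) , λ g∈ e∈g → ⊥-elim (uncovered (lose {P = Endpoint e} g∈ e∈g))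
... | yes covered with find covered
...   | (a , b) , f∈ , inj₁ refl = b , Adj-sym {u = a} {b} (All.lookup edges f∈) , λ g∈ e∈g →
        subst (λ g → Consecutive (proj₁ g) (proj₂ g) (b ∷ a ∷ [])) (matching-edge-unique disjoint f∈ g∈ (inj₁ refl) e∈g)
              (inj₁ (inj₂ (refl , refl)))
...   | (a , b) , f∈ , inj₂ refl = a , All.lookup edges f∈ , λ g∈ e∈g →
        subst (λ g → Consecutive (proj₁ g) (proj₂ g) (a ∷ b ∷ [])) (matching-edge-unique disjoint f∈ g∈ (inj₂ refl) e∈g)
              (inj₁ (inj₁ (refl , refl)))

NeighbourHamPath : ∀ {d} → List (Edge d) → V d → Set
NeighbourHamPath M e = ∃[ c ] Adj c e × ∃[ l ] IsHamPath Adj (ContainsEdges M) c l e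

neighbourHamPath : ∀ {d} → PathProperty (suc d) → ∀ M → IsMatching M → ∀ e → NeighbourHamPath M e
neighbourHamPath pp M M-matching@(edges , disjoint) e with matchedNeighbour M M-matching e
... | e' , e'~e , at-e
  with PathProperty⇒IsHamPath pp M∖e M∖e-matching e e' (Adj⇒OppositeParity {u = e} {e'} (Adj-sym {u = e'} {e} e'~e)) e-uncovered
  where
  M∖e : List (Edge _)
  M∖e = filter (λ g → ¬? (Endpoint? e g)) M
  M∖e-matching : IsMatching M∖e
  M∖e-matching = Allₚ.filter⁺ (λ g → ¬? (Endpoint? e g)) edges , AllPairsₚ.filter⁺ (λ g → ¬? (Endpoint? e g)) disjoint
  e-uncovered : ¬ Covered e M∖e
  e-uncovered covered with find covered
  ... | g , g∈ , e∈g = proj₂ (∈-filter⁻ (λ g → ¬? (Endpoint? e g)) {xs = M} g∈) e∈g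
... | [] , hamPath _ _ refl _ = ⊥-elim (Adj-irrefl {u = e} e'~e)
... | c ∷ l , hamPath unique spanning (e~c , walk) contains =
  c , Adj-sym {u = e} {c} e~c , l ++ [ e ] ,
  hamPath (Unique-resp-↭ rotation unique) (λ w → ↭ₚ.∈-resp-↭ rotation (spanning w)) (Walk-++ l [] walk e'~e refl) (All.tabulate contained)
  where
  rotation : e ∷ c ∷ l ↭ c ∷ l ++ [ e ]
  rotation = ↭ₚ.++-comm [ e ] (c ∷ l)
  contained : ∀ {g} → g ∈ M → Consecutive (proj₁ g) (proj₂ g) (c ∷ l ++ [ e ])
  contained {a , b} g∈ with Endpoint? e (a , b)
  ... | yes e∈g with Walk-last l walk
  ...   | l' , c∷l≡ = subst (Consecutive a b) (trans (sym (++-assoc l' [ e' ] [ e ])) (cong (_++ [ e ]) (sym c∷l≡)))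
                          (Consecutive-++ʳ l' (e' ∷ e ∷ []) (at-e g∈ e∈g))
  contained {a , b} g∈ | no e∉g =
    Consecutive-++ˡ (c ∷ l) [ e ] (Consecutive-∷⁻ (c ∷ l) (λ a≡e → e∉g (inj₁ (sym a≡e))) (λ b≡e → e∉g (inj₂ (sym b≡e)))
      (All.lookup contains (∈-filter⁺ (λ g → ¬? (Endpoint? e g)) g∈ e∉g)))

-- The product Q_m □ Q_d

xor-true : ∀ b → b xor true ≡ not b
xor-true true = refl
xor-true false = refl

xor-cancelʳ : ∀ a k → (a xor k) xor k ≡ a
xor-cancelʳ a k = trans (xor-assoc a k k) (trans (cong (a xor_) (xor-same k)) (xor-identityʳ a))

≢⇒≡not : ∀ {b c : Bool} → b ≢ c → b ≡ not c
≢⇒≡not {false} {false} b≢c = ⊥-elim (b≢c refl)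
≢⇒≡not {false} {true} _ = refl
≢⇒≡not {true} {false} _ = refl
≢⇒≡not {true} {true} b≢c = ⊥-elim (b≢c refl)

module ProductCube {d : ℕ} where

  Vertex□ : ℕ → Set
  Vertex□ m = V m × V d

  Adj□ : ∀ {m} → Vertex□ m → Vertex□ m → Set
  Adj□ (w , x) (w' , x') = (w ≡ w' × Adj x x') ⊎ (Adj w w' × x ≡ x')

  FibreMatchings : ℕ → Set
  FibreMatchings m = V m → List (Edge d)

  ContainsFibreEdges : ∀ {m} → FibreMatchings m → List (Vertex□ m) → Set
  ContainsFibreEdges Mf L = ∀ w → All (λ (a , b) → Consecutive (w , a) (w , b) L) (Mf w)

  FibredHamPath : ∀ {m} → FibreMatchings m → Vertex□ m → List (Vertex□ m) → Vertex□ m → Set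
  FibredHamPath Mf = IsHamPath Adj□ (ContainsFibreEdges Mf)

  AreMatchings : ∀ {m} → FibreMatchings m → Set
  AreMatchings Mf = ∀ w → IsMatching (Mf w)

  inHalf : ∀ {m} → Bool → Vertex□ m → Vertex□ (suc m)
  inHalf β (w , x) = β ∷ w , x

  inHalf-injective : ∀ {m β} {y y' : Vertex□ m} → inHalf β y ≡ inHalf β y' → y ≡ y'
  inHalf-injective {y = w , x} {w' , x'} refl = refl

  Adj□-inHalf : ∀ {m β} {y y' : Vertex□ m} → Adj□ y y' → Adj□ (inHalf β y) (inHalf β y')
  Adj□-inHalf {y = w , x} {w' , x'} (inj₁ (refl , ad)) = inj₁ (refl , ad)
  Adj□-inHalf {y = w , x} {w' , x'} (inj₂ (ad , refl)) = inj₂ (Adj-∷ ad , refl)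

  Adj□-across : ∀ {m} β (y : Vertex□ m) → Adj□ (inHalf β y) (inHalf (not β) y)
  Adj□-across β (w , x) = inj₂ (Adj-head (b≢not-b β) , refl)

  concatHalves : ∀ {m} (Mf : FibreMatchings (suc m)) β {h₁ l₁ z₁ h₂ l₂ z₂} →
                 FibredHamPath (Mf ∘ (β ∷_)) h₁ l₁ z₁ → FibredHamPath (Mf ∘ (not β ∷_)) h₂ l₂ z₂ →
                 Adj□ (inHalf β z₁) (inHalf (not β) h₂) →
                 FibredHamPath Mf (inHalf β h₁) (map (inHalf β) l₁ ++ inHalf (not β) h₂ ∷ map (inHalf (not β)) l₂) (inHalf (not β) z₂)
  concatHalves {m} Mf β {h₁} {l₁} {z₁} {h₂} {l₂} (hamPath unique₁ spanning₁ walk₁ contains₁) (hamPath unique₂ spanning₂ walk₂ contains₂) bridge =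
    hamPath (Uniqueₚ.++⁺ (Uniqueₚ.map⁺ inHalf-injective unique₁) (Uniqueₚ.map⁺ inHalf-injective unique₂) halves-disjoint)
            spanning
            (Walk-++ (map (inHalf β) l₁) (map (inHalf (not β)) l₂) (Walk-map (inHalf β) Adj□-inHalf l₁ walk₁) bridge
                     (Walk-map (inHalf (not β)) Adj□-inHalf l₂ walk₂))
            contains
    where
    first second : List (Vertex□ (suc m))
    first = map (inHalf β) (h₁ ∷ l₁)
    second = map (inHalf (not β)) (h₂ ∷ l₂)
    halves-disjoint : ∀ {z} → z ∈ first × z ∈ second → ⊥
    halves-disjoint (z∈₁ , z∈₂) with ∈-map⁻ (inHalf β) z∈₁ | ∈-map⁻ (inHalf (not β)) z∈₂
    ... | _ , _ , refl | _ , _ , eq = b≢not-b β (cong (Vec.head ∘ proj₁) eq)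
    spanning : ∀ y → y ∈ first ++ second
    spanning (b ∷ w , x) with b ≟ᵇ β
    ... | yes refl = ∈-++⁺ˡ (∈-map⁺ (inHalf β) (spanning₁ (w , x)))
    ... | no b≢β rewrite ≢⇒≡not b≢β = ∈-++⁺ʳ first (∈-map⁺ (inHalf (not β)) (spanning₂ (w , x)))
    contains : ContainsFibreEdges Mf (first ++ second)
    contains (b ∷ w) with b ≟ᵇ β
    ... | yes refl = All.map (Consecutive-++ˡ first second ∘ Consecutive-map (inHalf β) (h₁ ∷ l₁)) (contains₁ w)
    ... | no b≢β rewrite ≢⇒≡not b≢β = All.map (Consecutive-++ʳ first second ∘ Consecutive-map (inHalf (not β)) (h₂ ∷ l₂)) (contains₂ w)

  fibre₀ : ∀ (Mf : FibreMatchings 0) {x l z} → IsHamPath Adj (ContainsEdges (Mf [])) x l z → FibredHamPath Mf ([] , x) (map ([] ,_) l) ([] , z)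
  fibre₀ Mf {x} {l} (hamPath unique spanning walk contains) =
    hamPath (Uniqueₚ.map⁺ (cong proj₂) unique)
            (λ { ([] , y) → ∈-map⁺ ([] ,_) (spanning y) })
            (Walk-map ([] ,_) (λ ad → inj₁ (refl , ad)) l walk)
            (λ { [] → All.map (Consecutive-map ([] ,_) (x ∷ l)) contains })

  joinHalves : ∀ {m} (Mf : FibreMatchings (suc m)) β t' {c c₂ e l₁ l₂} →
               FibredHamPath (Mf ∘ (β ∷_)) (t' , c) l₁ (flipHead t' , c₂) →
               FibredHamPath (Mf ∘ (not β ∷_)) (flipHead t' , c₂) l₂ (flipHead (flipHead t') , e) →
               ∃[ l ] FibredHamPath Mf (β ∷ t' , c) l (not β ∷ t' , e)
  joinHalves Mf β t' {c} {c₂} {e} {l₁} {l₂} P₁ P₂ =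
    l , subst (λ w → FibredHamPath Mf (β ∷ t' , c) l (not β ∷ w , e)) (flipHead-involutive t') (concatHalves Mf β P₁ P₂ (Adj□-across β _))
    where
    l : List (Vertex□ _)
    l = map (inHalf β) l₁ ++ inHalf (not β) (flipHead t' , c₂) ∷ map (inHalf (not β)) l₂

  PathAcross : ∀ {m} → FibreMatchings m → V m → V d → V d → Set
  PathAcross Mf t c e = ∃[ l ] FibredHamPath Mf (t , c) l (flipHead t , e)

  FibredHamCycle : ∀ {m} → FibreMatchings m → Set
  FibredHamCycle Mf = ∃[ h ] ∃[ l ] ∃[ z ] FibredHamPath Mf h l z × Adj□ z h

  module _ (neighbourPath : ∀ (M : List (Edge d)) → IsMatching M → ∀ e → NeighbourHamPath M e)
           (pathBetween : ∀ (M : List (Edge d)) → IsMatching M → ∀ u v → OppositeParity u v → ¬ Covered u M →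
                          ∃[ l ] IsHamPath Adj (ContainsEdges M) u l v) where

    -- The path has an even number 2^(m+d) of vertices, so its ends have opposite parity. For m = 0 this
    -- is a statement about c and e; for m ≥ 1 the Q_m-coordinates t and flipHead t already differ in parity.
    pathAcross : ∀ m (Mf : FibreMatchings m) → AreMatchings Mf → ∀ t e → ∃[ c ] parity c ≡ parity e xor (m ≡ᵇ 0) × PathAcross Mf t c e
    pathAcross zero Mf matchings [] e with neighbourPath (Mf []) (matchings []) e
    ... | c , c~e , l , path = c , trans (Adj⇒parity≡not {u = c} {e} c~e) (sym (xor-true (parity e))) , map ([] ,_) l , fibre₀ Mf path
    pathAcross (suc m) Mf matchings (β ∷ t') e with pathAcross m (Mf ∘ (not β ∷_)) (matchings ∘ (not β ∷_)) (flipHead t') e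
    ... | c₂ , c₂-parity , _ , P₂ with pathAcross m (Mf ∘ (β ∷_)) (matchings ∘ (β ∷_)) t' c₂
    ... | c , c-parity , _ , P₁ =
      c , trans c-parity (trans (cong (_xor (m ≡ᵇ 0)) c₂-parity) (trans (xor-cancelʳ (parity e) (m ≡ᵇ 0)) (sym (xor-identityʳ (parity e))))) ,
      joinHalves Mf β t' P₁ P₂

    pathAcrossFrom : ∀ m (Mf : FibreMatchings m) → AreMatchings Mf → ∀ t a e → ¬ Covered a (Mf t) →
                     parity a ≡ parity e xor (m ≡ᵇ 0) → PathAcross Mf t a e
    pathAcrossFrom zero Mf matchings [] a e uncovered a-parity with pathBetween (Mf []) (matchings []) a e opposite uncovered
      where
      opposite : OppositeParity a e
      opposite = parity≢⇒OppositeParity {u = a} {e} λ eq → b≢not-b (parity e) (trans (sym eq) (trans a-parity (xor-true (parity e))))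
    ... | l , path = map ([] ,_) l , fibre₀ Mf path
    pathAcrossFrom (suc m) Mf matchings (β ∷ t') a e uncovered a-parity
      with pathAcross m (Mf ∘ (not β ∷_)) (matchings ∘ (not β ∷_)) (flipHead t') e
    ... | c₂ , c₂-parity , _ , P₂ =
      joinHalves Mf β t' (proj₂ (pathAcrossFrom m (Mf ∘ (β ∷_)) (matchings ∘ (β ∷_)) t' a c₂ uncovered a-parity′)) P₂
      where
      a-parity′ : parity a ≡ parity c₂ xor (m ≡ᵇ 0)
      a-parity′ = trans a-parity (trans (xor-identityʳ (parity e))
                    (sym (trans (cong (_xor (m ≡ᵇ 0)) c₂-parity) (xor-cancelʳ (parity e) (m ≡ᵇ 0)))))

    fibredHamCycle : ∀ m (Mf : FibreMatchings m) → AreMatchings Mf → ∀ s a → ¬ Covered a (Mf s) → FibredHamCycle Mf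
    fibredHamCycle zero Mf matchings [] a _ with neighbourPath (Mf []) (matchings []) a
    ... | c , c~a , l , path = ([] , c) , map ([] ,_) l , ([] , a) , fibre₀ Mf path , inj₁ (refl , Adj-sym {u = c} {a} c~a)
    fibredHamCycle (suc m) Mf matchings s a uncovered with pathAcrossFrom (suc m) Mf matchings s a a uncovered (sym (xor-identityʳ (parity a)))
    ... | l , path = (s , a) , l , (flipHead s , a) , path , inj₂ (Adj-sym {u = s} {flipHead s} (Adj-flipHead s) , refl)

-- Splitting the coordinates

predecessor : ∀ {n} → Fin (suc n) → Maybe (Fin n)
predecessor zero = nothing
predecessor (suc i) = just i

data Interleaving : ℕ → ℕ → ℕ → Set where
  none : Interleaving 0 0 0
  outer : ∀ {m d n} → Interleaving m d n → Interleaving (suc m) d (suc n)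
  inner : ∀ {m d n} → Interleaving m d n → Interleaving m (suc d) (suc n)

interleave : ∀ {m d n} → Interleaving m d n → V m → V d → V n
interleave none [] [] = []
interleave (outer p) (b ∷ w) x = b ∷ interleave p w x
interleave (inner p) w (b ∷ x) = b ∷ interleave p w x

outerPart : ∀ {m d n} → Interleaving m d n → V n → V m
outerPart none [] = []
outerPart (outer p) (b ∷ v) = b ∷ outerPart p v
outerPart (inner p) (b ∷ v) = outerPart p v

innerPart : ∀ {m d n} → Interleaving m d n → V n → V d
innerPart none [] = []
innerPart (outer p) (b ∷ v) = innerPart p v
innerPart (inner p) (b ∷ v) = b ∷ innerPart p v

isInner : ∀ {m d n} → Interleaving m d n → Fin n → Bool
isInner (outer p) zero = false
isInner (outer p) (suc i) = isInner p i
isInner (inner p) zero = true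
isInner (inner p) (suc i) = isInner p i

interleave-parts : ∀ {m d n} (p : Interleaving m d n) v → interleave p (outerPart p v) (innerPart p v) ≡ v
interleave-parts none [] = refl
interleave-parts (outer p) (b ∷ v) = cong (b ∷_) (interleave-parts p v)
interleave-parts (inner p) (b ∷ v) = cong (b ∷_) (interleave-parts p v)

outerPart-interleave : ∀ {m d n} (p : Interleaving m d n) w x → outerPart p (interleave p w x) ≡ w
outerPart-interleave none [] [] = refl
outerPart-interleave (outer p) (b ∷ w) x = cong (b ∷_) (outerPart-interleave p w x)
outerPart-interleave (inner p) w (b ∷ x) = outerPart-interleave p w x

innerPart-interleave : ∀ {m d n} (p : Interleaving m d n) w x → innerPart p (interleave p w x) ≡ x
innerPart-interleave none [] [] = refl
innerPart-interleave (outer p) (b ∷ w) x = innerPart-interleave p w x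
innerPart-interleave (inner p) w (b ∷ x) = cong (b ∷_) (innerPart-interleave p w x)

Adj-interleaveʳ : ∀ {m d n} (p : Interleaving m d n) w {x x'} → Adj x x' → Adj (interleave p w x) (interleave p w x')
Adj-interleaveʳ none [] {[]} {[]} (() , _)
Adj-interleaveʳ (outer p) (b ∷ w) ad = Adj-∷ (Adj-interleaveʳ p w ad)
Adj-interleaveʳ (inner p) w {b ∷ x} {b' ∷ x'} ad with Adj-∷⁻ {u = x} {x'} ad
... | inj₁ (b≢b' , refl) = Adj-head b≢b'
... | inj₂ (refl , ad') = Adj-∷ (Adj-interleaveʳ p w ad')

Adj-interleaveˡ : ∀ {m d n} (p : Interleaving m d n) {w w'} x → Adj w w' → Adj (interleave p w x) (interleave p w' x)
Adj-interleaveˡ none {[]} {[]} [] (() , _)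
Adj-interleaveˡ (inner p) (b ∷ x) ad = Adj-∷ (Adj-interleaveˡ p x ad)
Adj-interleaveˡ (outer p) {b ∷ w} {b' ∷ w'} x ad with Adj-∷⁻ {u = w} {w'} ad
... | inj₁ (b≢b' , refl) = Adj-head b≢b'
... | inj₂ (refl , ad') = Adj-∷ (Adj-interleaveˡ p x ad')

AdjDir-isInner : ∀ {m d n} (p : Interleaving m d n) {u v i} → AdjDir u v i → isInner p i ≡ true →
                 outerPart p u ≡ outerPart p v × Adj (innerPart p u) (innerPart p v)
AdjDir-isInner (outer p) {a ∷ u} {b ∷ v} {suc i} ad inner-i with AdjDir-suc⁻ {u = u} {v} ad
... | refl , ad' = Product.map (cong (a ∷_)) id (AdjDir-isInner p ad' inner-i)
AdjDir-isInner (inner p) {a ∷ u} {b ∷ v} {zero} ad _ with AdjDir-zero⁻ {u = u} {v} ad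
... | a≢b , refl = refl , Adj-head a≢b
AdjDir-isInner (inner p) {a ∷ u} {b ∷ v} {suc i} ad inner-i with AdjDir-suc⁻ {u = u} {v} ad
... | refl , ad' = Product.map id Adj-∷ (AdjDir-isInner p ad' inner-i)

allInner : ∀ n → Interleaving 0 n n
allInner zero = none
allInner (suc n) = inner (allInner n)

isInner-allInner : ∀ n i → isInner (allInner n) i ≡ true
isInner-allInner (suc n) zero = refl
isInner-allInner (suc n) (suc i) = isInner-allInner n i

interleavingFor : ∀ n d (D : List (Fin n)) → length D ≤ d → d ≤ n →
                  ∃[ m ] Σ (Interleaving m d n) λ p → ∀ i → i ∈ D → isInner p i ≡ true
interleavingFor zero zero [] _ _ = 0 , none , λ _ ()
interleavingFor (suc n) d D |D|≤d d≤n with d ℕₚ.≟ suc n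
... | yes refl = 0 , allInner (suc n) , λ i _ → isInner-allInner (suc n) i
... | no d≢n with zero ∈? D
  where open import Data.List.Membership.DecPropositional Finₚ._≟_ using (_∈?_)
...   | no 0∉D with interleavingFor n d (mapMaybe predecessor D) (ℕₚ.≤-trans (length-mapMaybe predecessor D) |D|≤d)
                                 (ℕₚ.≤-pred (ℕₚ.≤∧≢⇒< d≤n d≢n))
...     | m , p , inner-D = suc m , outer p , inner-D′
  where
  inner-D′ : ∀ i → i ∈ D → isInner (outer p) i ≡ true
  inner-D′ zero 0∈D = ⊥-elim (0∉D 0∈D)
  inner-D′ (suc i) i+1∈D = inner-D i (∈-mapMaybe⁺ predecessor i+1∈D refl)
interleavingFor (suc n) zero [] _ _ | no _ | yes ()
interleavingFor (suc n) (suc d) D |D|≤d d≤n | no d≢n | yes 0∈D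
  with interleavingFor n d (mapMaybe predecessor D) (ℕₚ.≤-pred (ℕₚ.≤-trans (length-mapMaybe-< predecessor 0∈D refl) |D|≤d))
                       (ℕₚ.≤-pred (ℕₚ.≤-trans (ℕₚ.n≤1+n (suc d)) (ℕₚ.≤∧≢⇒< d≤n d≢n)))
...   | m , p , inner-D = m , inner p , inner-D′
  where
  inner-D′ : ∀ i → i ∈ D → isInner (inner p) i ≡ true
  inner-D′ zero _ = refl
  inner-D′ (suc i) i+1∈D = inner-D i (∈-mapMaybe⁺ predecessor i+1∈D refl)

module Fibres {m d n} (p : Interleaving m d n) where

  restrictEdge : V m → Edge n → Maybe (Edge d)
  restrictEdge w (u , v) with outerPart p u ≟V w
  ... | yes _ = just (innerPart p u , innerPart p v)
  ... | no _ = nothing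

  restrictEdge-just⁻ : ∀ w {u v f} → restrictEdge w (u , v) ≡ just f → outerPart p u ≡ w × f ≡ (innerPart p u , innerPart p v)
  restrictEdge-just⁻ w {u} eq with outerPart p u ≟V w
  restrictEdge-just⁻ w refl | yes u∈w = u∈w , refl

  restrictEdge-outerPart : ∀ {u v} → restrictEdge (outerPart p u) (u , v) ≡ just (innerPart p u , innerPart p v)
  restrictEdge-outerPart {u} with outerPart p u ≟V outerPart p u
  ... | yes _ = refl
  ... | no ne = ⊥-elim (ne refl)

  fibreMatching : List (Edge n) → V m → List (Edge d)
  fibreMatching M w = mapMaybe (restrictEdge w) M

  InFibre : Edge n → Set
  InFibre (u , v) = outerPart p u ≡ outerPart p v × Adj (innerPart p u) (innerPart p v)

  embed : V m × V d → V n
  embed (w , x) = interleave p w x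

  Endpoint-embed : ∀ {f w z} → InFibre f → outerPart p (proj₁ f) ≡ w →
                   Endpoint z (innerPart p (proj₁ f) , innerPart p (proj₂ f)) → Endpoint (embed (w , z)) f
  Endpoint-embed {u , v} _ refl (inj₁ refl) = inj₁ (interleave-parts p u)
  Endpoint-embed {u , v} (same-fibre , _) refl (inj₂ refl) =
    inj₂ (trans (cong (λ w → interleave p w (innerPart p v)) same-fibre) (interleave-parts p v))

  fibreMatching-isMatching : ∀ M → IsMatching M → All InFibre M → ∀ w → IsMatching (fibreMatching M w)
  fibreMatching-isMatching M (edges , disjoint) in-fibre w =
    All-mapMaybe⁺ (restrictEdge w) M (λ f∈ eq → restricted-edge (All.lookup in-fibre f∈) eq) ,
    AllPairs-mapMaybe⁺ (restrictEdge w) disjoint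
      (λ f∈ f'∈ eq eq' apart → restricted-disjoint eq eq' apart (All.lookup in-fibre f∈) (All.lookup in-fibre f'∈))
    where
    restricted-edge : ∀ {f g} → InFibre f → restrictEdge w f ≡ just g → IsEdge g
    restricted-edge {u , v} (_ , ad) eq with restrictEdge-just⁻ w eq
    ... | _ , refl = ad
    restricted-disjoint : ∀ {f f' g g'} → restrictEdge w f ≡ just g → restrictEdge w f' ≡ just g' →
                          Disjoint f f' → InFibre f → InFibre f' → Disjoint g g'
    restricted-disjoint {u , v} {u' , v'} eq eq' apart f-in f'-in z z∈g z∈g' with restrictEdge-just⁻ w eq | restrictEdge-just⁻ w eq'
    ... | u∈w , refl | u'∈w , refl = apart (embed (w , z)) (Endpoint-embed f-in u∈w z∈g) (Endpoint-embed f'-in u'∈w z∈g')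

  fibreMatching-uncovered : ∀ M → All InFibre M → ∀ u → ¬ Covered u M → ¬ Covered (innerPart p u) (fibreMatching M (outerPart p u))
  fibreMatching-uncovered M in-fibre u uncovered covered with find covered
  ... | g , g∈ , u∈g with ∈-mapMaybe⁻ (restrictEdge (outerPart p u)) M g∈
  ... | f , f∈ , eq with restrictEdge-just⁻ (outerPart p u) eq
  ... | f∈u , refl = uncovered (lose f∈ (subst (λ z → Endpoint z f) (interleave-parts p u) (Endpoint-embed (All.lookup in-fibre f∈) f∈u u∈g)))

  open ProductCube {d} using (Adj□; FibredHamCycle)

  embed-injective : ∀ {y y'} → embed y ≡ embed y' → y ≡ y'
  embed-injective {w , x} {w' , x'} eq =
    cong₂ _,_ (trans (sym (outerPart-interleave p w x)) (trans (cong (outerPart p) eq) (outerPart-interleave p w' x')))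
              (trans (sym (innerPart-interleave p w x)) (trans (cong (innerPart p) eq) (innerPart-interleave p w' x')))

  Adj-embed : ∀ {y y'} → Adj□ y y' → Adj (embed y) (embed y')
  Adj-embed {w , x} (inj₁ (refl , ad)) = Adj-interleaveʳ p w ad
  Adj-embed {w , x} (inj₂ (ad , refl)) = Adj-interleaveˡ p x ad

  HamCycle-embed : ∀ M → All InFibre M → FibredHamCycle (fibreMatching M) → ∃[ C ] HamCycle C × All (λ e → EdgeOfCycle e C) M
  HamCycle-embed M in-fibre (h , l , z , hamPath unique spanning walk contains , z~h) =
    C , ((Uniqueₚ.map⁺ embed-injective unique , C-spanning) ,
         Walk⇒IsWalk (map embed l ++ [ embed h ]) (Walk-++ (map embed l) [] (Walk-map embed Adj-embed l walk) (Adj-embed z~h) refl)) ,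
    All.tabulate C-contains
    where
    C : List (V n)
    C = map embed (h ∷ l)
    C-spanning : ∀ v → v ∈ C
    C-spanning v = subst (_∈ C) (interleave-parts p v) (∈-map⁺ embed (spanning (outerPart p v , innerPart p v)))
    C-contains : ∀ {f} → f ∈ M → EdgeOfCycle f C
    C-contains {u , v} f∈ = Consecutive⇒EdgeOf (u , v) (embed h ∷ map embed l ++ [ embed h ]) (Consecutive-++ˡ C [ embed h ]
      (subst₂ (λ a b → Consecutive a b C) (interleave-parts p u)
              (trans (cong (λ w → interleave p w (innerPart p v)) (proj₁ (All.lookup in-fibre f∈))) (interleave-parts p v))
        (Consecutive-map embed (h ∷ l)
          (All.lookup (contains (outerPart p u)) (∈-mapMaybe⁺ (restrictEdge (outerPart p u)) f∈ restrictEdge-outerPart)))))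

perfectMatching-HamCycle : ∀ {n} (M : List (Edge (suc n))) → IsMatching M → (∀ v → Covered v M) →
                           ∃[ C ] HamCycle C × All (λ e → EdgeOfCycle e C) M
perfectMatching-HamCycle {n} M (edges , disjoint) perfect with fink n M M-pairing
  where
  M-pairing : IsPairing M
  M-pairing = mkPairing (Unique-unpair⁺ M (All.map (λ {(u , v)} → Adj⇒≢ {u = u} {v}) edges) disjoint) spanning
    where
    spanning : ∀ v → v ∈ unpair M
    spanning v with find (perfect v)
    ... | f , f∈ , v∈f = ∈-unpair⁺ f∈ v∈f
... | (x , y) ∷ l , mkAltHamCycle (mkPairing unique spanning) ⊆±M cyclic =
  unpair C ,
  ((unique , spanning) , Walk⇒IsWalk {u = x} {x} (y ∷ unpair l ++ [ x ]) (All.head adjacent , Linked⇒Walk l (All.tail adjacent) cyclic)) ,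
  All.tabulate contains
  where
  C : List (Edge (suc n))
  C = (x , y) ∷ l
  adjacent : All (λ (a , b) → Adj a b) C
  adjacent = All.map (λ { {a , b} (inj₁ q∈) → All.lookup edges q∈ ; {a , b} (inj₂ q∈) → Adj-sym {u = b} {a} (All.lookup edges q∈) }) ⊆±M
  contains : ∀ {f} → f ∈ M → EdgeOfCycle f (unpair C)
  contains {a , b} f∈ with ∈-unpair⁻ C (spanning a)
  ... | q , q∈ , a∈q = Consecutive⇒EdgeOf (a , b) (x ∷ y ∷ unpair l ++ [ x ]) (Consecutive-++ˡ (unpair C) [ x ] (in-cycle (All.lookup ⊆±M q∈)))
    where
    in-cycle : q ∈± M → Consecutive a b (unpair C)
    in-cycle (inj₁ q∈M) with matching-edge-unique disjoint q∈M f∈ a∈q (inj₁ refl)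
    ... | refl = Consecutive-unpair C q∈
    in-cycle (inj₂ q∈M) with matching-edge-unique disjoint q∈M f∈ (Sum.swap a∈q) (inj₁ refl)
    ... | refl = Consecutive-sym (unpair C) (Consecutive-unpair C q∈)

perfect⊎uncovered : ∀ {n} (M : List (Edge n)) → (∀ v → Covered v M) ⊎ ∃[ u ] ¬ Covered u M
perfect⊎uncovered {n} M with All.all? (λ v → Covered? v M) (vertices n)
... | yes all-covered = inj₁ λ v → All.lookup all-covered (∈-vertices v)
... | no not-all with find (Allₚ.¬All⇒Any¬ (λ v → Covered? v M) (vertices n) not-all)
...   | u , _ , uncovered = inj₂ (u , uncovered)

fibreMatching-HamCycle : ∀ {m d n} (p : Interleaving m (suc d) n) → PathProperty (suc d) →
                         ∀ M → IsMatching M → All (Fibres.InFibre p) M → ∀ u → ¬ Covered u M →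
                         ∃[ C ] HamCycle C × All (λ e → EdgeOfCycle e C) M
fibreMatching-HamCycle {m} p pp M M-matching in-fibre u uncovered =
  HamCycle-embed M in-fibre
    (fibredHamCycle (neighbourHamPath pp) (PathProperty⇒IsHamPath pp) m (fibreMatching M) (fibreMatching-isMatching M M-matching in-fibre)
                    (outerPart p u) (innerPart p u) (fibreMatching-uncovered M in-fibre u uncovered))
  where
  open Fibres p
  open ProductCube

theorem5 : ∀ (n d : ℕ) → 2 ≤ d → d ≤ n →
    (M : List (Edge n)) → IsMatching M → SpansAtMost d M →
    PathProperty d →
    ∃[ C ] HamCycle C × All (λ e → EdgeOfCycle e C) M
theorem5 zero (suc (suc d)) (s≤s (s≤s z≤n)) ()
theorem5 (suc n) (suc (suc d)) (s≤s (s≤s z≤n)) d≤n M M-matching (D , |D|≤d , directions) pp with perfect⊎uncovered M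
... | inj₁ perfect = perfectMatching-HamCycle M M-matching perfect
... | inj₂ (u , uncovered) with interleavingFor (suc n) (suc (suc d)) D |D|≤d d≤n
...   | m , p , D-inner = fibreMatching-HamCycle p pp M M-matching in-fibre u uncovered
  where
  in-fibre : All (Fibres.InFibre p) M
  in-fibre = All.map (λ (i , i∈D , ad) → AdjDir-isInner p ad (D-inner i i∈D)) directions
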